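{- The processor $\mathit{Proc}_{\mathtt{subcrit}}$ that maps a DP problem $(\mathcal P_1\uplus\mathcal P_2,\mathcal R,m,f)$ with $m\succeq\mathtt{minimal}$ to $\{(\mathcal P_2,\mathcal R,m,f)\}$ if there exists a projection function $\nu$ for $\mathcal P_1\uplus\mathcal P_2$ such that $\overline\nu(\ell)\rhd\overline\nu(p)$ for all $\ell\Rrightarrow p\ (A)\in\mathcal P_1$ and $\overline\nu(\ell)=\overline\nu(p)$ for all $\ell\Rrightarrow p\ (A)\in\mathcal P_2$ (and maps every other DP problem $N$ to $\{N\}$) is sound and complete.
   Context: Basic notions (higher-order rewriting with meta-variables). Types are built from sorts by $\to$. There are disjoint sets of function symbols, variables $\mathcal V$ and meta-variables (each typed; meta-variables $Z$ have an arity; infinitely many variables and meta-variables of each type). Meta-terms are built from variables, function symbols, application $s\,t$, abstraction $\lambda x.s$ and meta-variable applications $Z\langle s_1,..,s_k\rangle$ ($k=\mathit{arity}(Z)$), all well-typed; terms are meta-terms without meta-variables; modulo $\alpha$; $FV,FMV$ = free variables, meta-variables; closed = no free variables. Subterms: $s\unrhd t$ iff $s=t$ or $s\rhd t$, where $\lambda x.s'\rhd t$ if $s'\unrhd t$ and $s_1s_2\rhd t$ if $s_1\unrhd t$ or $s_2\unrhd t$. A pattern is $Z\langle x_1..x_k\rangle$ (distinct variables), $\lambda x.\ell$, or $a\,\ell_1\cdots\ell_n$ with $a$ a function symbol or variable. Substitutions map variables/meta-variables to (meta-)terms; $Z\langle s_1..s_k\rangle\gamma=u[x_1:=s_1\gamma..x_n:=s_n\gamma](s_{n+1}\gamma)\cdots(s_k\gamma)$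 if $\gamma(Z)=\lambda x_1..x_n.u$ ($n=k$, or $n<k$ and $u$ not an abstraction), otherwise substitution is homomorphic and capture-avoiding. A rule is $\ell\Rightarrow r$ with $\ell,r$ closed meta-terms of the same type, $\ell$ a pattern $\mathsf f\,\ell_1\cdots\ell_n$, $FMV(r)\subseteq FMV(\ell)$. $\to_{\mathcal R}$ is the closure under all contexts of $\ell\delta\to r\delta$ ($\ell\Rightarrow r\in\mathcal R$, $\mathrm{dom}(\delta)=FMV(\ell)$) and $\beta$: $(\lambda x.s)t\to s[x:=t]$. The signature used for terms contains marked symbols $\mathsf f^\sharp$, and for each type countably many symbols not used in the rules. Dependency pairs: a DP is a triple $\ell\Rrightarrow p\ (A)$ with $\ell$ a closed pattern $\mathsf f\,\ell_1\cdots\ell_k$, $p$ a closed meta-term $\mathsf g\,p_1\cdots p_n$, $A$ a set of conditions $Z:i$; conservative if $FMV(p)\subseteq FMV(\ell)$. $\gamma$ respects $A$ if for all $Z:i\in A$, $\gamma(Z)=\lambda x_1..x_j.t$ with $i>j$ or ($i\le j$ and $x_i\in FV(t)$). $s\trianglerighteq^\beta_A t$: $s=t$; or $s=\lambda x.u$, $u\trianglerighteq^\beta_A t$; or $s=(\lambda x.u)s_0\cdots s_n$ and some $s_i\trianglerighteq^\beta_At$ or $u[x:=s_0]s_1\cdots s_n\trianglerighteq^\beta_At$; or $s=a\,s_1\cdots s_n$ ($a$ function symbol or variable) and some $s_i\trianglerighteq^\beta_At$; or $s=Z\langle t_1..t_e\rangle s_1\cdots s_n$ and some $s_i\trianglerighteq^\beta_At$,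 or some $t_i\trianglerighteq^\beta_At$ with $(Z:i)\in A$. Chains: a $(\mathcal P,\mathcal R)$-chain is a finite or infinite sequence $[(\ell_0\Rrightarrow p_0(A_0),s_0,t_0),\dots]$ of DPs in $\mathcal P$ and terms such that for all $i$ some substitution $\gamma_i$ on domain $FMV(\ell_i)\cup FMV(p_i)$ respecting $A_i$ has $s_i=\ell_i\gamma_i,t_i=p_i\gamma_i$, and $t_i=\mathsf f\,u_1\cdots u_n$, $s_{i+1}=\mathsf f\,w_1\cdots w_n$ with $u_j\to^*_{\mathcal R}w_j$. Minimal: strict subterms of all $t_i$ are $\to_{\mathcal R}$-terminating. Computable: fix a sort quasi-ordering with well-founded strict part; $\iota\succeq_+\sigma_1\to..\to\sigma_m\to\kappa$ iff $\iota\succeq\kappa$ and $\iota\succ_-\sigma_i$ for all $i$; $\iota\succ_-\sigma$ iff $\iota\succ\kappa$ and $\iota\succeq_+\sigma_i$ for all $i$; $\mathit{Acc}(\mathsf f)=\{i\mid\iota\succeq_+\sigma_i\}$ for $\mathsf f:\sigma_1\to..\to\sigma_m\to\iota$. For rules $\mathcal U$, an RC-set is a set $I$ of base-type terms, all $\to_{\mathcal U}$-terminating, closed under $\to_{\mathcal U}$, containing each $x\,s_1..s_n$ ($x\in\mathcal V$) or $(\lambda x.u)s_0..s_n$ whose reducts all lie in $I$; $I$-computable: base-type terms in $I$, and $s:\sigma\to\tau$ with $s\,t$ $I$-computable for all $I$-computable $t$. $\mathsf f\,s_1..s_m\rightsquigarrow_I s_i\,t_1..t_n$ if both sides have base type,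 $i\in\mathit{Acc}(\mathsf f)$, all $t_j$ $I$-computable. $C_{\mathcal U}$ is an RC-set with $C_{\mathcal U}=\{s$ base type, terminating under $\to_{\mathcal U}\cup\rightsquigarrow_{C_{\mathcal U}}$, with $s\to^*_{\mathcal U}\mathsf f\,s_1..s_m$ implying $s_i$ $C_{\mathcal U}$-computable for $i\in\mathit{Acc}(\mathsf f)\}$. A chain is $\mathcal U$-computable if $\to_{\mathcal U}\supseteq\to_{\mathcal R}$ and for all $i$, $(\lambda x_1..x_n.v)\gamma_i$ is $C_{\mathcal U}$-computable whenever $p_i\trianglerighteq^\beta_Bv$, $\gamma_i$ respects $B$, $FV(v)=\{x_1..x_n\}$. Formative: a reduction $s\to^*_{\mathcal R}\ell\gamma$ is $\ell$-formative if inductively: $\ell$ is not fully extended linear (a meta-variable occurs twice, or $\ell$ has a sub-meta-term $\lambda x.C[Z\langle\vec s\rangle]$ with $x\notin\vec s$); or $\ell=Z\langle\vec x\rangle$ and $s=\ell\gamma$; or $s=a\,s_1..s_n$, $\ell=a\,\ell_1..\ell_n$ ($a$ a (marked) function symbol or variable) with $s_i\to^*\ell_i\gamma$ $\ell_i$-formative; or $s=\lambda x.s'$, $\ell=\lambda x.\ell'$, $s'\to^*\ell'\gamma$ $\ell'$-formative; or $s=(\lambda x.u)v\,w_1..w_n$ and $u[x:=v]w_1..w_n\to^*\ell\gamma$ $\ell$-formative; or $\ell$ is not a meta-variable application and there are a rule $\ell'\Rightarrow r'$, meta-variables $Z_1..Z_n$, $\delta$ with $s\to^*(\ell'Z_1..Z_n)\delta$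 $(\ell'Z_1..Z_n)$-formative and $(r'Z_1..Z_n)\delta\to^*\ell\gamma$ $\ell$-formative. A chain is formative if each $t_i\to^*_{\mathcal R}s_{i+1}$ is $\ell_{i+1}$-formative. DP problems: $(\mathcal P,\mathcal R,m,f)$ with $m\in\{\mathtt{minimal},\mathtt{arbitrary}\}\cup\{\mathtt{computable}_{\mathcal U}\mid\mathcal U$ a set of rules$\}$, $f\in\{\mathtt{formative},\mathtt{all}\}$. $\succeq$ on flags is the reflexive-transitive relation generated by $\mathtt{computable}_{\mathcal U}\succeq\mathtt{minimal}\succeq\mathtt{arbitrary}$. Finite: no infinite $(\mathcal P,\mathcal R)$-chain that is $\mathcal U$-computable if $m=\mathtt{computable}_{\mathcal U}$, minimal if $m=\mathtt{minimal}$, formative if $f=\mathtt{formative}$. Infinite: $\to_{\mathcal R}$ non-terminating or an infinite $(\mathcal P,\mathcal R)$-chain with only conservative DPs exists. A processor maps a DP problem to NO or a set of DP problems; sound if $M$ is finite whenever $\mathit{Proc}(M)\ne$ NO and all its elements are finite; complete if $M$ is infinite whenever $\mathit{Proc}(M)=$ NO or contains an infinite element. Projection functions: for a set $\mathcal P$ of DPs, $\mathtt{heads}(\mathcal P)$ is the set of symbols occurring as head of a left- or right-hand side of a DP in $\mathcal P$. A projection function for $\mathcal P$ is $\nu:\mathtt{heads}(\mathcal P)\to\mathbb N$ such that for all $\ell\Rrightarrow p\ (A)\in\mathcal P$ the map $\overline\nu(\mathsf f\,s_1\cdots s_n)=s_{\nu(\mathsf f)}$ is well-defined on $\ell$ and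 on $p$ (i.e. $1\le\nu(\mathsf f)\le n$). -}

module Defs where

open import Level using (Lift) renaming (zero to lzero; suc to lsuc)
open import Data.Bool using (Bool; true; false; T)
open import Data.Nat using (ℕ; zero; suc; _≤_; pred)
open import Data.Unit using (⊤; tt)
open import Data.Empty using (⊥)
open import Data.Product using (Σ; Σ-syntax; ∃; _×_; _,_; proj₁; proj₂)
open import Data.Sum using (_⊎_)
open import Data.Maybe using (Maybe; just; nothing)
open import Data.List using (List; []; _∷_; _++_; [_])
open import Data.List.Relation.Unary.Any using (here; there)
open import Data.List.Relation.Unary.All using (All)
open import Data.List.Membership.Propositional using (_∈_)
open import Data.List.Membership.Propositional.Properties using (∈-++⁺ˡ; ∈-++⁺ʳ)
open import Data.List.Relation.Unary.Unique.Propositional using (Unique)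
open import Relation.Nullary using (¬_)
open import Relation.Binary.PropositionalEquality using (_≡_; refl; subst)
open import Relation.Binary.Structures using (IsPreorder)
open import Relation.Binary.Construct.Closure.ReflexiveTransitive using (Star)
open import Induction.WellFounded using (WellFounded; Acc)

data Ty (S : Set) : Set where
  base : S → Ty S
  _⇒_  : Ty S → Ty S → Ty S

infixr 20 _⇒_

record Signature : Set₁ where
  field
    Sort    : Set
    Fun     : Set
    funTy   : Fun → Ty Sort
    _⊒_     : Sort → Sort → Set
    ⊒-isPreorder : IsPreorder _≡_ _⊒_
    ⊐-wellFounded : WellFounded (λ κ ι → (ι ⊒ κ) × ¬ (κ ⊒ ι))

module Rewriting (Sig : Signature) where
  open Signature Sig public

  Type : Set
  Type = Ty Sort

  Ctx : Set
  Ctx = List Type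

  _⇒*_ : List Type → Type → Type
  []       ⇒* τ = τ
  (a ∷ as) ⇒* τ = a ⇒ (as ⇒* τ)

  infixr 19 _⇒*_

  argTys : Type → List Type
  argTys (base _) = []
  argTys (σ ⇒ τ)  = σ ∷ argTys τ

  resSort : Type → Sort
  resSort (base ι) = ι
  resSort (σ ⇒ τ)  = resSort τ

  -- Symbols used in terms: unmarked f, marked f♯ (same type as f), and
  -- for every type countably many fresh symbols (never used in rules).

  data Sym : Set where
    usr   : Fun → Sym
    mrk   : Fun → Sym
    fresh : Type → ℕ → Sym

  symTy : Sym → Type
  symTy (usr f)     = funTy f
  symTy (mrk f)     = funTy f
  symTy (fresh σ _) = σ

  record MVar : Set where
    constructor mv
    field
      name  : ℕ
      margs : List Type
      mres  : Type
  open MVar public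

  mvTy : MVar → Type
  mvTy Z = margs Z ⇒* mres Z

  -- (Meta-)terms: de Bruijn indices for bound variables, named free
  -- variables (fvar n of type σ), meta-variable applications only when
  -- b = true.  Tm true = meta-terms, Tm false = terms.

  mutual
    data Tm (b : Bool) : Ctx → Type → Set where
      bvar : ∀ {Γ σ} → σ ∈ Γ → Tm b Γ σ
      fvar : ∀ {Γ σ} → ℕ → Tm b Γ σ
      con  : ∀ {Γ} (f : Sym) → Tm b Γ (symTy f)
      app  : ∀ {Γ σ τ} → Tm b Γ (σ ⇒ τ) → Tm b Γ σ → Tm b Γ τ
      lam  : ∀ {Γ σ τ} → Tm b (σ ∷ Γ) τ → Tm b Γ (σ ⇒ τ)
      meta : ∀ {Γ} (Z : MVar) → T b → Args b Γ (margs Z) → Tm b Γ (mres Z)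

    data Args (b : Bool) : Ctx → List Type → Set where
      []  : ∀ {Γ} → Args b Γ []
      _∷_ : ∀ {Γ σ σs} → Tm b Γ σ → Args b Γ σs → Args b Γ (σ ∷ σs)

  MTerm : Ctx → Type → Set
  MTerm = Tm true

  Term : Ctx → Type → Set
  Term = Tm false

  argsList : ∀ {b Γ as} → Args b Γ as → List (Σ Type (Tm b Γ))
  argsList []       = []
  argsList (t ∷ ts) = (_ , t) ∷ argsList ts

  Ren : Ctx → Ctx → Set
  Ren Γ Δ = ∀ {a} → a ∈ Γ → a ∈ Δ

  liftR : ∀ {Γ Δ σ} → Ren Γ Δ → Ren (σ ∷ Γ) (σ ∷ Δ)
  liftR ρ (here p)  = here p
  liftR ρ (there x) = there (ρ x)

  mutual
    ren : ∀ {b Γ Δ σ} → Ren Γ Δ → Tm b Γ σ → Tm b Δ σ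
    ren ρ (bvar x)      = bvar (ρ x)
    ren ρ (fvar n)      = fvar n
    ren ρ (con f)       = con f
    ren ρ (app s t)     = app (ren ρ s) (ren ρ t)
    ren ρ (lam s)       = lam (ren (liftR ρ) s)
    ren ρ (meta Z p ts) = meta Z p (renA ρ ts)

    renA : ∀ {b Γ Δ as} → Ren Γ Δ → Args b Γ as → Args b Δ as
    renA ρ []       = []
    renA ρ (t ∷ ts) = ren ρ t ∷ renA ρ ts

  wk0 : ∀ {b Ξ σ} → Tm b [] σ → Tm b Ξ σ
  wk0 = ren (λ ())

  Subst : Bool → Ctx → Ctx → Set
  Subst b Γ Δ = ∀ {a} → a ∈ Γ → Tm b Δ a

  liftS : ∀ {b Γ Δ σ} → Subst b Γ Δ → Subst b (σ ∷ Γ) (σ ∷ Δ)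
  liftS θ (here refl) = bvar (here refl)
  liftS θ (there x)   = ren there (θ x)

  ext : ∀ {b Γ Δ σ} → Subst b Γ Δ → Tm b Δ σ → Subst b (σ ∷ Γ) Δ
  ext θ s (here refl) = s
  ext θ s (there x)   = θ x

  mutual
    sub : ∀ {b Γ Δ σ} → Subst b Γ Δ → Tm b Γ σ → Tm b Δ σ
    sub θ (bvar x)      = θ x
    sub θ (fvar n)      = fvar n
    sub θ (con f)       = con f
    sub θ (app s t)     = app (sub θ s) (sub θ t)
    sub θ (lam s)       = lam (sub (liftS θ) s)
    sub θ (meta Z p ts) = meta Z p (subA θ ts)

    subA : ∀ {b Γ Δ as} → Subst b Γ Δ → Args b Γ as → Args b Δ as
    subA θ []       = []
    subA θ (t ∷ ts) = sub θ t ∷ subA θ ts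

  sub0 : ∀ {b Γ σ τ} → Tm b Γ σ → Tm b (σ ∷ Γ) τ → Tm b Γ τ
  sub0 s u = sub (ext bvar s) u

  apps : ∀ {b Γ as τ} → Tm b Γ (as ⇒* τ) → Args b Γ as → Tm b Γ τ
  apps t []       = t
  apps t (s ∷ ss) = apps (app t s) ss

  data LamView {b Γ} : ∀ {ρ} → Tm b Γ ρ → Set where
    isLam  : ∀ {σ τ} (u : Tm b (σ ∷ Γ) τ) → LamView (lam u)
    notLam : ∀ {ρ} {t : Tm b Γ ρ} → LamView t

  lamView : ∀ {b Γ ρ} (t : Tm b Γ ρ) → LamView t
  lamView (lam u) = isLam u
  lamView t       = notLam

  -- A substitution maps every meta-variable Z to a
  -- term of type mvTy Z (values outside the relevant domain are ignored).
  -- Z⟨s1..sk⟩γ = u[x1:=s1γ..xn:=snγ](s(n+1)γ)..(skγ) where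
  -- γ(Z) = λx1..xn.u with n = k, or n < k and u not an abstraction.

  MSub : Ctx → Set
  MSub Γ = (Z : MVar) → Term Γ (mvTy Z)

  inst : ∀ {Θ Ψ as τ} → Term Θ (as ⇒* τ) → Subst false Θ Ψ → Args false Ψ as → Term Ψ τ
  inst {as = []}     t θ []       = sub θ t
  inst {as = a ∷ as} t θ (s ∷ ss) with lamView t
  ... | isLam u = inst u (ext θ s) ss
  ... | notLam  = apps (sub θ t) (s ∷ ss)

  mutual
    msub : ∀ {Δ Γ τ} → MTerm Δ τ → MSub Γ → Term (Δ ++ Γ) τ
    msub (bvar x)      γ = bvar (∈-++⁺ˡ x)
    msub (fvar n)      γ = fvar n
    msub (con f)       γ = con f
    msub (app s t)     γ = app (msub s γ) (msub t γ)
    msub (lam s)       γ = lam (msub s γ)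
    msub {Δ} (meta Z _ ts) γ = inst (γ Z) (λ x → bvar (∈-++⁺ʳ Δ x)) (msubA ts γ)

    msubA : ∀ {Δ Γ as} → Args true Δ as → MSub Γ → Args false (Δ ++ Γ) as
    msubA []       γ = []
    msubA (t ∷ ts) γ = msub t γ ∷ msubA ts γ

  -- s ⊵ t : t is a subterm of s (t may contain variables bound in s)
  data _⊵_ {b} : ∀ {Γ σ Δ τ} → Tm b Γ σ → Tm b Δ τ → Set where
    ⊵here : ∀ {Γ σ} {s : Tm b Γ σ} → s ⊵ s
    ⊵lam  : ∀ {Γ σ ρ Δ τ} {u : Tm b (ρ ∷ Γ) σ} {t : Tm b Δ τ} → u ⊵ t → lam u ⊵ t
    ⊵appl : ∀ {Γ σ ρ Δ τ} {f : Tm b Γ (ρ ⇒ σ)} {x : Tm b Γ ρ} {t : Tm b Δ τ} → f ⊵ t → app f x ⊵ t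
    ⊵appr : ∀ {Γ σ ρ Δ τ} {f : Tm b Γ (ρ ⇒ σ)} {x : Tm b Γ ρ} {t : Tm b Δ τ} → x ⊵ t → app f x ⊵ t

  data _▷_ {b} : ∀ {Γ σ Δ τ} → Tm b Γ σ → Tm b Δ τ → Set where
    ▷lam  : ∀ {Γ σ ρ Δ τ} {u : Tm b (ρ ∷ Γ) σ} {t : Tm b Δ τ} → u ⊵ t → lam u ▷ t
    ▷appl : ∀ {Γ σ ρ Δ τ} {f : Tm b Γ (ρ ⇒ σ)} {x : Tm b Γ ρ} {t : Tm b Δ τ} → f ⊵ t → app f x ▷ t
    ▷appr : ∀ {Γ σ ρ Δ τ} {f : Tm b Γ (ρ ⇒ σ)} {x : Tm b Γ ρ} {t : Tm b Δ τ} → x ⊵ t → app f x ▷ t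

  headSym : ∀ {b Γ σ} → Tm b Γ σ → Maybe Sym
  headSym (con f)   = just f
  headSym (app f x) = headSym f
  headSym _         = nothing

  args : ∀ {b Γ σ} → Tm b Γ σ → List (Σ Type (Tm b Γ))
  args (app f x) = args f ++ [ (_ , x) ]
  args _         = []

  -- 1-based lookup
  nth1 : ∀ {A : Set} → List A → ℕ → Maybe A
  nth1 []       _             = nothing
  nth1 (x ∷ xs) zero          = nothing
  nth1 (x ∷ xs) (suc zero)    = just x
  nth1 (x ∷ xs) (suc (suc n)) = nth1 xs (suc n)

  data IsVar {b Γ} : ∀ {σ} → Tm b Γ σ → Set where
    isBVar : ∀ {σ} {x : σ ∈ Γ} → IsVar (bvar x)
    isFVar : ∀ {σ} {n : ℕ} → IsVar (fvar {σ = σ} n)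

  data IsMetaApp {b Γ} : ∀ {σ} → Tm b Γ σ → Set where
    isMeta : ∀ {Z p} {ts : Args b Γ (margs Z)} → IsMetaApp (meta Z p ts)

  mutual
    data HasFVar {b} : ∀ {Γ σ} → Tm b Γ σ → Set where
      hf-here : ∀ {Γ σ n} → HasFVar (fvar {b} {Γ} {σ} n)
      hf-appl : ∀ {Γ σ τ} {f : Tm b Γ (σ ⇒ τ)} {x} → HasFVar f → HasFVar (app f x)
      hf-appr : ∀ {Γ σ τ} {f : Tm b Γ (σ ⇒ τ)} {x} → HasFVar x → HasFVar (app f x)
      hf-lam  : ∀ {Γ σ τ} {u : Tm b (σ ∷ Γ) τ} → HasFVar u → HasFVar (lam u)
      hf-meta : ∀ {Γ Z p} {ts : Args b Γ (margs Z)} → HasFVarA ts → HasFVar (meta Z p ts)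

    data HasFVarA {b} : ∀ {Γ as} → Args b Γ as → Set where
      hfa-here  : ∀ {Γ σ σs} {t : Tm b Γ σ} {ts : Args b Γ σs} → HasFVar t → HasFVarA (t ∷ ts)
      hfa-there : ∀ {Γ σ σs} {t : Tm b Γ σ} {ts : Args b Γ σs} → HasFVarA ts → HasFVarA (t ∷ ts)

  Closed : ∀ {b Γ σ} → Tm b Γ σ → Set
  Closed t = ¬ HasFVar t

  mutual
    data OccBV {b} : ∀ {Γ a σ} → a ∈ Γ → Tm b Γ σ → Set where
      ob-here : ∀ {Γ a} {x : a ∈ Γ} → OccBV x (bvar x)
      ob-appl : ∀ {Γ a σ τ} {x : a ∈ Γ} {f : Tm b Γ (σ ⇒ τ)} {y} → OccBV x f → OccBV x (app f y)
      ob-appr : ∀ {Γ a σ τ} {x : a ∈ Γ} {f : Tm b Γ (σ ⇒ τ)} {y} → OccBV x y → OccBV x (app f y)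
      ob-lam  : ∀ {Γ a σ τ} {x : a ∈ Γ} {u : Tm b (σ ∷ Γ) τ} → OccBV (there x) u → OccBV x (lam u)
      ob-meta : ∀ {Γ a Z p} {x : a ∈ Γ} {ts : Args b Γ (margs Z)} → OccBVA x ts → OccBV x (meta Z p ts)

    data OccBVA {b} : ∀ {Γ a as} → a ∈ Γ → Args b Γ as → Set where
      oba-here  : ∀ {Γ a σ σs} {x : a ∈ Γ} {t : Tm b Γ σ} {ts : Args b Γ σs} → OccBV x t → OccBVA x (t ∷ ts)
      oba-there : ∀ {Γ a σ σs} {x : a ∈ Γ} {t : Tm b Γ σ} {ts : Args b Γ σs} → OccBVA x ts → OccBVA x (t ∷ ts)

  -- meta-variable occurrences: Z ∈ FMV(t), and "Z occurs at least twice"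
  mutual
    data MOcc (Z : MVar) {b} : ∀ {Γ σ} → Tm b Γ σ → Set where
      mo-here : ∀ {Γ p} {ts : Args b Γ (margs Z)} → MOcc Z (meta Z p ts)
      mo-arg  : ∀ {Γ Z' p} {ts : Args b Γ (margs Z')} → MOccA Z ts → MOcc Z (meta Z' p ts)
      mo-appl : ∀ {Γ σ τ} {f : Tm b Γ (σ ⇒ τ)} {x} → MOcc Z f → MOcc Z (app f x)
      mo-appr : ∀ {Γ σ τ} {f : Tm b Γ (σ ⇒ τ)} {x} → MOcc Z x → MOcc Z (app f x)
      mo-lam  : ∀ {Γ σ τ} {u : Tm b (σ ∷ Γ) τ} → MOcc Z u → MOcc Z (lam u)

    data MOccA (Z : MVar) {b} : ∀ {Γ as} → Args b Γ as → Set where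
      moa-here  : ∀ {Γ σ σs} {t : Tm b Γ σ} {ts : Args b Γ σs} → MOcc Z t → MOccA Z (t ∷ ts)
      moa-there : ∀ {Γ σ σs} {t : Tm b Γ σ} {ts : Args b Γ σs} → MOccA Z ts → MOccA Z (t ∷ ts)

  mutual
    data MOcc2 (Z : MVar) {b} : ∀ {Γ σ} → Tm b Γ σ → Set where
      mt-self : ∀ {Γ p} {ts : Args b Γ (margs Z)} → MOccA Z ts → MOcc2 Z (meta Z p ts)
      mt-arg  : ∀ {Γ Z' p} {ts : Args b Γ (margs Z')} → MOcc2A Z ts → MOcc2 Z (meta Z' p ts)
      mt-both : ∀ {Γ σ τ} {f : Tm b Γ (σ ⇒ τ)} {x} → MOcc Z f → MOcc Z x → MOcc2 Z (app f x)
      mt-appl : ∀ {Γ σ τ} {f : Tm b Γ (σ ⇒ τ)} {x} → MOcc2 Z f → MOcc2 Z (app f x)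
      mt-appr : ∀ {Γ σ τ} {f : Tm b Γ (σ ⇒ τ)} {x} → MOcc2 Z x → MOcc2 Z (app f x)
      mt-lam  : ∀ {Γ σ τ} {u : Tm b (σ ∷ Γ) τ} → MOcc2 Z u → MOcc2 Z (lam u)

    data MOcc2A (Z : MVar) {b} : ∀ {Γ as} → Args b Γ as → Set where
      mta-both  : ∀ {Γ σ σs} {t : Tm b Γ σ} {ts : Args b Γ σs} → MOcc Z t → MOccA Z ts → MOcc2A Z (t ∷ ts)
      mta-here  : ∀ {Γ σ σs} {t : Tm b Γ σ} {ts : Args b Γ σs} → MOcc2 Z t → MOcc2A Z (t ∷ ts)
      mta-there : ∀ {Γ σ σs} {t : Tm b Γ σ} {ts : Args b Γ σs} → MOcc2A Z ts → MOcc2A Z (t ∷ ts)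

  -- some meta-variable application Z⟨s⃗⟩ below (the binder of) x with x ∉ s⃗
  mutual
    data MMiss {b} : ∀ {Γ a σ} → a ∈ Γ → Tm b Γ σ → Set where
      mm-here : ∀ {Γ a Z p} {x : a ∈ Γ} {ts : Args b Γ (margs Z)} →
                ¬ ((a , bvar x) ∈ argsList ts) → MMiss x (meta Z p ts)
      mm-arg  : ∀ {Γ a Z p} {x : a ∈ Γ} {ts : Args b Γ (margs Z)} → MMissA x ts → MMiss x (meta Z p ts)
      mm-appl : ∀ {Γ a σ τ} {x : a ∈ Γ} {f : Tm b Γ (σ ⇒ τ)} {y} → MMiss x f → MMiss x (app f y)
      mm-appr : ∀ {Γ a σ τ} {x : a ∈ Γ} {f : Tm b Γ (σ ⇒ τ)} {y} → MMiss x y → MMiss x (app f y)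
      mm-lam  : ∀ {Γ a σ τ} {x : a ∈ Γ} {u : Tm b (σ ∷ Γ) τ} → MMiss (there x) u → MMiss x (lam u)

    data MMissA {b} : ∀ {Γ a as} → a ∈ Γ → Args b Γ as → Set where
      mma-here  : ∀ {Γ a σ σs} {x : a ∈ Γ} {t : Tm b Γ σ} {ts : Args b Γ σs} → MMiss x t → MMissA x (t ∷ ts)
      mma-there : ∀ {Γ a σ σs} {x : a ∈ Γ} {t : Tm b Γ σ} {ts : Args b Γ σs} → MMissA x ts → MMissA x (t ∷ ts)

  NotFEL : ∀ {b Γ σ} → Tm b Γ σ → Set
  NotFEL {b} ℓ = (Σ MVar λ Z → MOcc2 Z ℓ)
               ⊎ (Σ Ctx λ Θ → Σ Type λ a → Σ Type λ τ → Σ (Tm b (a ∷ Θ) τ) λ u →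
                    (ℓ ⊵ lam u) × MMiss (here refl) u)

  mutual
    data Pattern {b} : ∀ {Γ σ} → Tm b Γ σ → Set where
      p-meta : ∀ {Γ Z p} {ts : Args b Γ (margs Z)} →
               All (λ q → IsVar (proj₂ q)) (argsList ts) → Unique (argsList ts) →
               Pattern (meta Z p ts)
      p-lam  : ∀ {Γ σ τ} {u : Tm b (σ ∷ Γ) τ} → Pattern u → Pattern (lam u)
      p-spine : ∀ {Γ σ} {t : Tm b Γ σ} → PSpine t → Pattern t

    data PSpine {b} : ∀ {Γ σ} → Tm b Γ σ → Set where
      ps-con  : ∀ {Γ f} → PSpine (con {b} {Γ} f)
      ps-bvar : ∀ {Γ σ} {x : σ ∈ Γ} → PSpine (bvar {b} x)
      ps-fvar : ∀ {Γ σ n} → PSpine (fvar {b} {Γ} {σ} n)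
      ps-app  : ∀ {Γ σ τ} {f : Tm b Γ (σ ⇒ τ)} {x} → PSpine f → Pattern x → PSpine (app f x)

  record Rule : Set where
    constructor _⇛_
    field
      {rty} : Type
      lhs   : MTerm [] rty
      rhs   : MTerm [] rty

  mutual
    data HasFresh {b} : ∀ {Γ σ} → Tm b Γ σ → Set where
      hr-here : ∀ {Γ σ n} → HasFresh (con {b} {Γ} (fresh σ n))
      hr-appl : ∀ {Γ σ τ} {f : Tm b Γ (σ ⇒ τ)} {x} → HasFresh f → HasFresh (app f x)
      hr-appr : ∀ {Γ σ τ} {f : Tm b Γ (σ ⇒ τ)} {x} → HasFresh x → HasFresh (app f x)
      hr-lam  : ∀ {Γ σ τ} {u : Tm b (σ ∷ Γ) τ} → HasFresh u → HasFresh (lam u)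
      hr-meta : ∀ {Γ Z p} {ts : Args b Γ (margs Z)} → HasFreshA ts → HasFresh (meta Z p ts)

    data HasFreshA {b} : ∀ {Γ as} → Args b Γ as → Set where
      hra-here  : ∀ {Γ σ σs} {t : Tm b Γ σ} {ts : Args b Γ σs} → HasFresh t → HasFreshA (t ∷ ts)
      hra-there : ∀ {Γ σ σs} {t : Tm b Γ σ} {ts : Args b Γ σs} → HasFreshA ts → HasFreshA (t ∷ ts)

  record WFRule (r : Rule) : Set where
    field
      lhsClosed  : Closed (Rule.lhs r)
      rhsClosed  : Closed (Rule.rhs r)
      lhsPattern : Pattern (Rule.lhs r)
      lhsHeadFun : ∃ λ f → headSym (Rule.lhs r) ≡ just f
      fmvSub     : ∀ Z → MOcc Z (Rule.rhs r) → MOcc Z (Rule.lhs r)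
      lhsNoFresh : ¬ HasFresh (Rule.lhs r)
      rhsNoFresh : ¬ HasFresh (Rule.rhs r)

  data HeadBeta {b} : ∀ {Γ σ} → Tm b Γ σ → Tm b Γ σ → Set where
    hb-here : ∀ {Γ σ τ} {u : Tm b (σ ∷ Γ) τ} {v} → HeadBeta (app (lam u) v) (sub0 v u)
    hb-app  : ∀ {Γ σ τ} {f f' : Tm b Γ (σ ⇒ τ)} {x} → HeadBeta f f' → HeadBeta (app f x) (app f' x)

  data Step (R : Rule → Set) : ∀ {Γ σ} → Term Γ σ → Term Γ σ → Set where
    rule  : ∀ {Γ} (r : Rule) → R r → (δ : MSub Γ) →
            Step R (msub (Rule.lhs r) δ) (msub (Rule.rhs r) δ)
    beta  : ∀ {Γ σ τ} {u : Term (σ ∷ Γ) τ} {v} → Step R (app (lam u) v) (sub0 v u)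
    appL  : ∀ {Γ σ τ} {f f' : Term Γ (σ ⇒ τ)} {x} → Step R f f' → Step R (app f x) (app f' x)
    appR  : ∀ {Γ σ τ} {f : Term Γ (σ ⇒ τ)} {x x'} → Step R x x' → Step R (app f x) (app f x')
    lamC  : ∀ {Γ σ τ} {u u' : Term (σ ∷ Γ) τ} → Step R u u' → Step R (lam u) (lam u')

  Steps : (Rule → Set) → ∀ {Γ σ} → Term Γ σ → Term Γ σ → Set
  Steps R = Star (Step R)

  Terminating : (Rule → Set) → ∀ {Γ σ} → Term Γ σ → Set
  Terminating R t = Acc (λ u s → Step R s u) t

  Cond : Set
  Cond = MVar × ℕ

  record DP : Set where
    constructor dp
    field
      {lty rty} : Type
      lhs   : MTerm [] lty
      rhs   : MTerm [] rty
      conds : List Cond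

  record WFDP (d : DP) : Set where
    field
      lhsClosed  : Closed (DP.lhs d)
      lhsPattern : Pattern (DP.lhs d)
      lhsHeadFun : ∃ λ f → headSym (DP.lhs d) ≡ just f
      rhsClosed  : Closed (DP.rhs d)
      rhsHeadFun : ∃ λ f → headSym (DP.rhs d) ≡ just f

  Conservative : DP → Set
  Conservative d = ∀ Z → MOcc Z (DP.rhs d) → MOcc Z (DP.lhs d)

  -- respecting a condition Z:i for a value t of γ(Z) (arity = length as):
  -- γ(Z) = λx1..xj.t (j maximal with j ≤ arity) and i > j, or i ≤ j and xi ∈ FV(t)
  respBody : ∀ {Γ τ} → Maybe (Σ Type (_∈ Γ)) → Term Γ τ → Set
  respBody nothing        t = ⊤
  respBody (just (_ , x)) t = OccBV x t

  respGo : ∀ {Γ τ} (as : List Type) → ℕ → Maybe (Σ Type (_∈ Γ)) → Term Γ (as ⇒* τ) → Set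
  respGo []       k tgt t = respBody tgt t
  respGo (a ∷ as) k tgt t with lamView t
  respGo (a ∷ as) (suc zero) nothing          t | isLam u = respGo as zero (just (a , here refl)) u
  respGo (a ∷ as) k          nothing          t | isLam u = respGo as (pred k) nothing u
  respGo (a ∷ as) k          (just (c , x))   t | isLam u = respGo as k (just (c , there x)) u
  respGo (a ∷ as) k          tgt              t | notLam  = respBody tgt t

  RespCond : (Z : MVar) → ℕ → Term [] (mvTy Z) → Set
  RespCond Z i t = (1 ≤ i) × respGo (margs Z) i nothing t

  Respects : ∀ {σ τ} → MTerm [] σ → MTerm [] τ → MSub [] → (Cond → Set) → Set
  Respects ℓ p γ A = ∀ Z i → A (Z , i) → (MOcc Z ℓ ⊎ MOcc Z p) → RespCond Z i (γ Z)

  data ArgRed (R : Rule → Set) : ∀ {Γ σ} → Term Γ σ → Term Γ σ → Set where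
    ar-head : ∀ {Γ f} → ArgRed R (con {false} {Γ} f) (con f)
    ar-app  : ∀ {Γ σ τ} {f g : Term Γ (σ ⇒ τ)} {x y} → ArgRed R f g → Steps R x y →
              ArgRed R (app f x) (app g y)

  record Chain (R : Rule → Set) (P : DP → Set) : Set where
    field
      pair   : ℕ → DP
      inP    : ∀ i → P (pair i)
      γ      : ℕ → MSub []
      resp   : ∀ i → Respects (DP.lhs (pair i)) (DP.rhs (pair i)) (γ i) (λ c → c ∈ DP.conds (pair i))
      tyEq   : ∀ i → DP.rty (pair i) ≡ DP.lty (pair (suc i))
      link   : ∀ i → ArgRed R (subst (Term []) (tyEq i) (msub (DP.rhs (pair i)) (γ i)))
                               (msub (DP.lhs (pair (suc i))) (γ (suc i)))

    s : ∀ i → Term [] (DP.lty (pair i))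
    s i = msub (DP.lhs (pair i)) (γ i)

    t : ∀ i → Term [] (DP.rty (pair i))
    t i = msub (DP.rhs (pair i)) (γ i)

  Minimal : ∀ {R P} → Chain R P → Set
  Minimal {R} c = ∀ i {Δ τ} (u : Term Δ τ) → Chain.t c i ▷ u → Terminating R u

  zapp : ∀ {Γ σs τ} → MTerm Γ (σs ⇒* τ) → All (λ _ → ℕ) σs → MTerm Γ τ
  zapp t All.[] = t
  zapp {σs = σ ∷ σs} t (n All.∷ ns) = zapp (app t (meta (mv n [] σ) tt [])) ns

  mutual
    data Form (R : Rule → Set) : ∀ {Δ Γ τ} → MTerm Δ τ → MSub Γ → Term (Δ ++ Γ) τ → Set where
      f-nfel  : ∀ {Δ Γ τ} {ℓ : MTerm Δ τ} {γ : MSub Γ} {s} →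
                NotFEL ℓ → Steps R s (msub ℓ γ) → Form R ℓ γ s
      f-meta  : ∀ {Δ Γ Z p} {ts : Args true Δ (margs Z)} {γ : MSub Γ} →
                All (λ q → IsVar (proj₂ q)) (argsList ts) →
                Form R (meta Z p ts) γ (msub (meta Z p ts) γ)
      f-spine : ∀ {Δ Γ τ} {ℓ : MTerm Δ τ} {γ : MSub Γ} {s} → FSpine R ℓ γ s → Form R ℓ γ s
      f-lam   : ∀ {Δ Γ σ τ} {ℓ : MTerm (σ ∷ Δ) τ} {γ : MSub Γ} {s} → Form R ℓ γ s → Form R (lam ℓ) γ (lam s)
      f-beta  : ∀ {Δ Γ τ} {ℓ : MTerm Δ τ} {γ : MSub Γ} {s s'} → HeadBeta s s' → Form R ℓ γ s' → Form R ℓ γ s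
      f-rule  : ∀ {Δ Γ τ} {ℓ : MTerm Δ τ} {γ : MSub Γ} {s} →
                ¬ IsMetaApp ℓ → (r : Rule) → R r →
                (σs : List Type) (eq : Rule.rty r ≡ σs ⇒* τ) (Zs : All (λ _ → ℕ) σs) (δ : MSub (Δ ++ Γ)) →
                Form R {[]} (zapp (subst (MTerm []) eq (Rule.lhs r)) Zs) δ s →
                Form R ℓ γ (msub (zapp (subst (MTerm []) eq (Rule.rhs r)) Zs) δ) →
                Form R ℓ γ s

    data FSpine (R : Rule → Set) : ∀ {Δ Γ τ} → MTerm Δ τ → MSub Γ → Term (Δ ++ Γ) τ → Set where
      fs-con  : ∀ {Δ Γ f} {γ : MSub Γ} → FSpine R (con {true} {Δ} f) γ (con f)
      fs-bvar : ∀ {Δ Γ σ} {x : σ ∈ Δ} {γ : MSub Γ} → FSpine R (bvar x) γ (bvar (∈-++⁺ˡ x))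
      fs-fvar : ∀ {Δ Γ σ n} {γ : MSub Γ} → FSpine R (fvar {true} {Δ} {σ} n) γ (fvar n)
      fs-app  : ∀ {Δ Γ σ τ} {ℓf : MTerm Δ (σ ⇒ τ)} {ℓx} {γ : MSub Γ} {sf sx} →
                FSpine R ℓf γ sf → Form R ℓx γ sx → FSpine R (app ℓf ℓx) γ (app sf sx)

  Formative : ∀ {R P} → Chain R P → Set
  Formative {R} c = ∀ i → Form R {[]} {[]} (DP.lhs (Chain.pair c (suc i))) (Chain.γ c (suc i))
                                 (subst (Term []) (Chain.tyEq c i) (Chain.t c i))

  mutual
    _⪰₊_ : Sort → Type → Set
    ι ⪰₊ base κ  = ι ⊒ κ
    ι ⪰₊ (σ ⇒ τ) = (ι ≻₋ σ) × (ι ⪰₊ τ)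

    _≻₋_ : Sort → Type → Set
    ι ≻₋ base κ  = (ι ⊒ κ) × ¬ (κ ⊒ ι)
    ι ≻₋ (σ ⇒ τ) = (ι ⪰₊ σ) × (ι ≻₋ τ)

  -- i ∈ Acc(f)   (1-based positions)
  AccArg : Sym → ℕ → Set
  AccArg f i = ∃ λ σ → nth1 (argTys (symTy f)) i ≡ just σ × (resSort (symTy f) ⪰₊ σ)

  BaseSet : Set₁
  BaseSet = (ι : Sort) → Term [] (base ι) → Set

  Comp : BaseSet → (σ : Type) → Term [] σ → Set
  Comp I (base ι) t = I ι t
  Comp I (σ ⇒ τ)  s = ∀ t → Comp I σ t → Comp I τ (app s t)

  data CompApps (I : BaseSet) {σ} (h : Term [] σ) : ∀ {τ} → Term [] τ → Set where
    ca-done : CompApps I h h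
    ca-step : ∀ {ρ τ} {u : Term [] (ρ ⇒ τ)} {x} → CompApps I h u → Comp I ρ x → CompApps I h (app u x)

  data Rsq (I : BaseSet) : ∀ {ι κ} → Term [] (base ι) → Term [] (base κ) → Set where
    rsq : ∀ {ι κ} {s : Term [] (base ι)} {u : Term [] (base κ)} (f : Sym) (i : ℕ) {σ} {si : Term [] σ} →
          headSym s ≡ just f → nth1 (args s) i ≡ just (σ , si) → AccArg f i →
          CompApps I si u → Rsq I s u

  BTerm : Set
  BTerm = Σ Sort λ ι → Term [] (base ι)

  data UStep (U : Rule → Set) (I : BaseSet) : BTerm → BTerm → Set where
    us-red : ∀ {ι} {s u : Term [] (base ι)} → Step U s u → UStep U I (ι , s) (ι , u)
    us-rsq : ∀ {ι κ} {s : Term [] (base ι)} {u : Term [] (base κ)} → Rsq I s u → UStep U I (ι , s) (κ , u)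

  data Neutral : ∀ {σ} → Term [] σ → Set where
    ne-var  : ∀ {σ n} → Neutral (fvar {false} {[]} {σ} n)
    ne-beta : ∀ {σ τ} {u : Term (σ ∷ []) τ} {v} → Neutral (app (lam u) v)
    ne-app  : ∀ {σ τ} {f : Term [] (σ ⇒ τ)} {x} → Neutral f → Neutral (app f x)

  record IsRC (U : Rule → Set) (I : BaseSet) : Set where
    field
      rc-term    : ∀ {ι} {t : Term [] (base ι)} → I ι t → Terminating U t
      rc-closed  : ∀ {ι} {t t' : Term [] (base ι)} → I ι t → Step U t t' → I ι t'
      rc-neutral : ∀ {ι} {t : Term [] (base ι)} → Neutral t → (∀ t' → Step U t t' → I ι t') → I ι t

  CUProperty : (U : Rule → Set) → BaseSet → (ι : Sort) → Term [] (base ι) → Set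
  CUProperty U I ι s =
    Acc (λ y x → UStep U I x y) (ι , s) ×
    (∀ s' → Steps U s s' → ∀ f i {σ} (si : Term [] σ) →
       headSym s' ≡ just f → nth1 (args s') i ≡ just (σ , si) → AccArg f i → Comp I σ si)

  IsCU : (U : Rule → Set) → BaseSet → Set
  IsCU U I = IsRC U I × (∀ ι s → (I ι s → CUProperty U I ι s) × (CUProperty U I ι s → I ι s))

  data ArgOf {b Γ} : ∀ {σ τ} → Tm b Γ σ → Tm b Γ τ → Set where
    ao-here : ∀ {σ τ} {f : Tm b Γ (σ ⇒ τ)} {x} → ArgOf (app f x) x
    ao-left : ∀ {σ τ ρ} {f : Tm b Γ (σ ⇒ τ)} {x} {y : Tm b Γ ρ} → ArgOf f y → ArgOf (app f x) y

  data MetaHeadArg (B : Cond → Set) {b Γ} : ∀ {σ τ} → Tm b Γ σ → Tm b Γ τ → Set where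
    mh-here : ∀ {Z p} {ts : Args b Γ (margs Z)} (i : ℕ) {τ} {t : Tm b Γ τ} →
              B (Z , i) → nth1 (argsList ts) i ≡ just (τ , t) → MetaHeadArg B (meta Z p ts) t
    mh-app  : ∀ {σ τ ρ} {f : Tm b Γ (σ ⇒ τ)} {x} {t : Tm b Γ ρ} → MetaHeadArg B f t → MetaHeadArg B (app f x) t

  data SupB (B : Cond → Set) {b} : ∀ {Γ σ Δ τ} → Tm b Γ σ → Tm b Δ τ → Set where
    sb-refl : ∀ {Γ σ} {s : Tm b Γ σ} → SupB B s s
    sb-lam  : ∀ {Γ σ ρ Δ τ} {u : Tm b (ρ ∷ Γ) σ} {t : Tm b Δ τ} → SupB B u t → SupB B (lam u) t
    sb-arg  : ∀ {Γ σ ρ Δ τ} {s : Tm b Γ σ} {s' : Tm b Γ ρ} {t : Tm b Δ τ} →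
              ArgOf s s' → SupB B s' t → SupB B s t
    sb-beta : ∀ {Γ σ Δ τ} {s s' : Tm b Γ σ} {t : Tm b Δ τ} → HeadBeta s s' → SupB B s' t → SupB B s t
    sb-meta : ∀ {Γ σ ρ Δ τ} {s : Tm b Γ σ} {s' : Tm b Γ ρ} {t : Tm b Δ τ} →
              MetaHeadArg B s s' → SupB B s' t → SupB B s t

  closeTy : Ctx → Type → Type
  closeTy []      τ = τ
  closeTy (a ∷ Θ) τ = closeTy Θ (a ⇒ τ)

  lams : ∀ {b} (Θ : Ctx) {τ} → Tm b Θ τ → Tm b [] (closeTy Θ τ)
  lams []      v = v
  lams (a ∷ Θ) v = lams Θ (lam v)

  InjectiveRen : ∀ {Θ Θ'} → Ren Θ' Θ → Set
  InjectiveRen {Θ' = Θ'} ρ = ∀ {a} (x y : a ∈ Θ') → ρ x ≡ ρ y → x ≡ y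

  UComputable : (CU : (Rule → Set) → BaseSet) (U : Rule → Set) → ∀ {R P} → Chain R P → Set₁
  UComputable CU U {R} c =
    (∀ {Γ σ} {s t : Term Γ σ} → Step R s t → Step U s t) ×
    (∀ i (B : Cond → Set) {Θ τ} (v : MTerm Θ τ) →
       SupB B (DP.rhs (Chain.pair c i)) v →
       Respects (DP.lhs (Chain.pair c i)) (DP.rhs (Chain.pair c i)) (Chain.γ c i) B →
       -- FV(v) = {x1..xn}: v is v' renamed injectively, every variable of v' occurring in v'
       ∀ {Θ'} (v' : MTerm Θ' τ) (ρ : Ren Θ' Θ) → InjectiveRen ρ → ren ρ v' ≡ v →
       (∀ {a} (x : a ∈ Θ') → OccBV x v') →
       Comp (CU U) (closeTy Θ' τ) (msub (lams Θ' v') (Chain.γ c i)))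

  data MFlag : Set₁ where
    minimal arbitrary : MFlag
    computable        : (Rule → Set) → MFlag

  data FFlag : Set where
    formative all : FFlag

  AtLeastMinimal : MFlag → Set
  AtLeastMinimal minimal        = ⊤
  AtLeastMinimal arbitrary      = ⊥
  AtLeastMinimal (computable _) = ⊤

  record DPProblem : Set₁ where
    constructor ⟨_,_,_,_⟩
    field
      P : DP → Set
      R : Rule → Set
      m : MFlag
      f : FFlag

  FlagRulesWF : MFlag → Set
  FlagRulesWF (computable U) = ∀ r → U r → WFRule r
  FlagRulesWF _              = ⊤

  WFProblem : DPProblem → Set
  WFProblem M = (∀ d → DPProblem.P M d → WFDP d) × (∀ r → DPProblem.R M r → WFRule r)
                × FlagRulesWF (DPProblem.m M)

  MCond : ((Rule → Set) → BaseSet) → MFlag → ∀ {R P} → Chain R P → Set₁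
  MCond CU minimal        c = Lift (lsuc lzero) (Minimal c)
  MCond CU arbitrary      c = Lift (lsuc lzero) ⊤
  MCond CU (computable U) c = UComputable CU U c

  FCond : FFlag → ∀ {R P} → Chain R P → Set
  FCond formative c = Formative c
  FCond all       c = ⊤

  Finite : ((Rule → Set) → BaseSet) → DPProblem → Set₁
  Finite CU ⟨ P , R , m , f ⟩ = ¬ (Σ (Chain R P) λ c → MCond CU m c × FCond f c)

  NonTerminating : (Rule → Set) → Set
  NonTerminating R = Σ Ctx λ Γ → Σ Type λ σ → Σ (ℕ → Term Γ σ) λ u → ∀ i → Step R (u i) (u (suc i))

  Infinite : DPProblem → Set
  Infinite ⟨ P , R , m , f ⟩ =
    NonTerminating R ⊎ (Σ (Chain R P) λ c → ∀ i → Conservative (Chain.pair c i))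

  proj : (Sym → ℕ) → ∀ {σ} → MTerm [] σ → Maybe (Σ Type (MTerm []))
  proj ν t with headSym t
  ... | just f  = nth1 (args t) (ν f)
  ... | nothing = nothing

  IsProjection : (Sym → ℕ) → (DP → Set) → Set
  IsProjection ν P = ∀ d → P d → (∃ λ u → proj ν (DP.lhs d) ≡ just u) × (∃ λ u → proj ν (DP.rhs d) ≡ just u)

  _▷c_ : Σ Type (MTerm []) → Σ Type (MTerm []) → Set
  (σ , u) ▷c (τ , v) = Σ Ctx λ Ξ → u ▷ wk0 {Ξ = Ξ} v

  record Applicable (M : DPProblem) (P₁ P₂ : DP → Set) (ν : Sym → ℕ) : Set where
    field
      atLeastMinimal : AtLeastMinimal (DPProblem.m M)
      split          : ∀ d → DPProblem.P M d → P₁ d ⊎ P₂ d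
      unsplit        : ∀ d → P₁ d ⊎ P₂ d → DPProblem.P M d
      disjoint       : ∀ d → P₁ d → P₂ d → ⊥
      projection     : IsProjection ν (DPProblem.P M)
      strict         : ∀ d → P₁ d → Σ (Σ Type (MTerm [])) λ u → Σ (Σ Type (MTerm [])) λ v →
                         proj ν (DP.lhs d) ≡ just u × proj ν (DP.rhs d) ≡ just v × (u ▷c v)
      equal          : ∀ d → P₂ d → proj ν (DP.lhs d) ≡ proj ν (DP.rhs d)

  data ProcSubcrit (M : DPProblem) : DPProblem → Set₁ where
    apply : ∀ (P₁ P₂ : DP → Set) ν → Applicable M P₁ P₂ ν →
            ProcSubcrit M ⟨ P₂ , DPProblem.R M , DPProblem.m M , DPProblem.f M ⟩
    other : (∀ (P₁ P₂ : DP → Set) ν → ¬ Applicable M P₁ P₂ ν) → ProcSubcrit M M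

-- Completeness is immediate: every chain of P₂ is a chain of P₁ ⊎ P₂.  For soundness, take an
-- infinite minimal (or computable) chain with sᵢ = ℓᵢγᵢ and tᵢ = pᵢγᵢ.  Since ν̄ selects an argument
-- and the chain only reduces arguments, ν̄(tᵢ) →*_R ν̄(sᵢ₊₁); moreover ν̄(sᵢ) = ν̄(tᵢ) for pairs of P₂
-- and ν̄(sᵢ) ▷ ν̄(tᵢ) for pairs of P₁.  A chain whose tail stays in P₂ is excluded by finiteness of
-- the smaller problem, so pairs of P₁ recur and ν̄(t₀) starts an infinite descent in (→_R ∪ ▷)⁺.
-- That relation is well-founded on terminating terms, because reductions of a subterm lift to the
-- whole term; and ν̄(t₀) terminates, being a strict subterm of t₀ (minimality) or computable
-- (computable terms terminate: apply them to variables, which are computable).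

module Submission where

open import Defs
open import Level using (lift)
open import Data.Bool using (true; false)
open import Data.Nat using (ℕ; zero; suc; _+_; _≤_; _<_; s≤s)
open import Data.Nat.Properties using (≤-refl; ≤-trans; m≤m+n; m≤n+m; m≤n⇒m≤1+n; +-suc)
open import Data.Nat.Induction using (<-wellFounded)
open import Data.Unit using (tt)
open import Data.Empty using (⊥; ⊥-elim)
open import Data.Product using (Σ; _×_; _,_; proj₁; proj₂)
open import Data.Sum using (_⊎_; inj₁; inj₂; [_,_]′)
open import Data.Maybe using (just; nothing)
import Data.Maybe as Maybe
open import Data.Maybe.Properties using (just-injective)
open import Data.List using (List; []; _∷_; _++_; [_]; map)
open import Data.List.Properties using (map-++)
open import Data.List.Relation.Unary.Any using (here; there)
open import Data.List.Relation.Unary.Any.Properties using (++⁻∘++⁺)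
open import Data.List.Membership.Propositional using (_∈_)
open import Data.List.Membership.Propositional.Properties using (∈-++⁺ˡ; ∈-++⁺ʳ; ∈-++⁻)
open import Data.List.Relation.Binary.Pointwise using (Pointwise; []; _∷_; ++⁺)
open import Relation.Nullary using (¬_)
open import Relation.Binary.PropositionalEquality using (_≡_; refl; sym; trans; cong; cong₂; subst; subst₂; module ≡-Reasoning)
open import Relation.Binary.Construct.Closure.ReflexiveTransitive using (Star; ε; _◅_; _◅◅_)
open import Relation.Binary.Construct.Closure.Transitive as Plus using (TransClosure; _∷_)
open import Induction.WellFounded using (Acc; acc)

module SubtermCriterion (Sig : Signature) where
  open Rewriting Sig

  mutual
    ren-cong : ∀ {b Γ Δ σ} {ρ ρ' : Ren Γ Δ} → (∀ {a} (x : a ∈ Γ) → ρ x ≡ ρ' x) →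
               (t : Tm b Γ σ) → ren ρ t ≡ ren ρ' t
    ren-cong h (bvar x)      = cong bvar (h x)
    ren-cong h (fvar n)      = refl
    ren-cong h (con f)       = refl
    ren-cong h (app s t)     = cong₂ app (ren-cong h s) (ren-cong h t)
    ren-cong h (lam s)       = cong lam (ren-cong (liftR-cong h) s)
    ren-cong h (meta Z p ts) = cong (meta Z p) (renA-cong h ts)

    renA-cong : ∀ {b Γ Δ as} {ρ ρ' : Ren Γ Δ} → (∀ {a} (x : a ∈ Γ) → ρ x ≡ ρ' x) →
                (ts : Args b Γ as) → renA ρ ts ≡ renA ρ' ts
    renA-cong h []       = refl
    renA-cong h (t ∷ ts) = cong₂ _∷_ (ren-cong h t) (renA-cong h ts)

    liftR-cong : ∀ {Γ Δ σ} {ρ ρ' : Ren Γ Δ} → (∀ {a} (x : a ∈ Γ) → ρ x ≡ ρ' x) →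
                 ∀ {a} (x : a ∈ σ ∷ Γ) → liftR ρ x ≡ liftR ρ' x
    liftR-cong h (here p)  = refl
    liftR-cong h (there x) = cong there (h x)

  mutual
    ren-id : ∀ {b Γ σ} {ρ : Ren Γ Γ} → (∀ {a} (x : a ∈ Γ) → ρ x ≡ x) → (t : Tm b Γ σ) → ren ρ t ≡ t
    ren-id h (bvar x)      = cong bvar (h x)
    ren-id h (fvar n)      = refl
    ren-id h (con f)       = refl
    ren-id h (app s t)     = cong₂ app (ren-id h s) (ren-id h t)
    ren-id h (lam s)       = cong lam (ren-id (liftR-id h) s)
    ren-id h (meta Z p ts) = cong (meta Z p) (renA-id h ts)

    renA-id : ∀ {b Γ as} {ρ : Ren Γ Γ} → (∀ {a} (x : a ∈ Γ) → ρ x ≡ x) → (ts : Args b Γ as) → renA ρ ts ≡ ts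
    renA-id h []       = refl
    renA-id h (t ∷ ts) = cong₂ _∷_ (ren-id h t) (renA-id h ts)

    liftR-id : ∀ {Γ σ} {ρ : Ren Γ Γ} → (∀ {a} (x : a ∈ Γ) → ρ x ≡ x) →
               ∀ {a} (x : a ∈ σ ∷ Γ) → liftR ρ x ≡ x
    liftR-id h (here p)  = refl
    liftR-id h (there x) = cong there (h x)

  liftR-∘ : ∀ {Γ Δ Ξ σ} (ρ : Ren Δ Ξ) (ρ' : Ren Γ Δ) {a} (x : a ∈ σ ∷ Γ) →
            liftR ρ (liftR ρ' x) ≡ liftR (λ y → ρ (ρ' y)) x
  liftR-∘ ρ ρ' (here p)  = refl
  liftR-∘ ρ ρ' (there x) = refl

  mutual
    ren-∘ : ∀ {b Γ Δ Ξ σ} (ρ : Ren Δ Ξ) (ρ' : Ren Γ Δ) (t : Tm b Γ σ) →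
            ren ρ (ren ρ' t) ≡ ren (λ x → ρ (ρ' x)) t
    ren-∘ ρ ρ' (bvar x)      = refl
    ren-∘ ρ ρ' (fvar n)      = refl
    ren-∘ ρ ρ' (con f)       = refl
    ren-∘ ρ ρ' (app s t)     = cong₂ app (ren-∘ ρ ρ' s) (ren-∘ ρ ρ' t)
    ren-∘ ρ ρ' (lam s)       = cong lam (trans (ren-∘ (liftR ρ) (liftR ρ') s) (ren-cong (liftR-∘ ρ ρ') s))
    ren-∘ ρ ρ' (meta Z p ts) = cong (meta Z p) (renA-∘ ρ ρ' ts)

    renA-∘ : ∀ {b Γ Δ Ξ as} (ρ : Ren Δ Ξ) (ρ' : Ren Γ Δ) (ts : Args b Γ as) →
             renA ρ (renA ρ' ts) ≡ renA (λ x → ρ (ρ' x)) ts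
    renA-∘ ρ ρ' []       = refl
    renA-∘ ρ ρ' (t ∷ ts) = cong₂ _∷_ (ren-∘ ρ ρ' t) (renA-∘ ρ ρ' ts)

  mutual
    sub-cong : ∀ {b Γ Δ σ} {θ θ' : Subst b Γ Δ} → (∀ {a} (x : a ∈ Γ) → θ x ≡ θ' x) →
               (t : Tm b Γ σ) → sub θ t ≡ sub θ' t
    sub-cong h (bvar x)      = h x
    sub-cong h (fvar n)      = refl
    sub-cong h (con f)       = refl
    sub-cong h (app s t)     = cong₂ app (sub-cong h s) (sub-cong h t)
    sub-cong h (lam s)       = cong lam (sub-cong (liftS-cong h) s)
    sub-cong h (meta Z p ts) = cong (meta Z p) (subA-cong h ts)

    subA-cong : ∀ {b Γ Δ as} {θ θ' : Subst b Γ Δ} → (∀ {a} (x : a ∈ Γ) → θ x ≡ θ' x) →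
                (ts : Args b Γ as) → subA θ ts ≡ subA θ' ts
    subA-cong h []       = refl
    subA-cong h (t ∷ ts) = cong₂ _∷_ (sub-cong h t) (subA-cong h ts)

    liftS-cong : ∀ {b Γ Δ σ} {θ θ' : Subst b Γ Δ} → (∀ {a} (x : a ∈ Γ) → θ x ≡ θ' x) →
                 ∀ {a} (x : a ∈ σ ∷ Γ) → liftS θ x ≡ liftS θ' x
    liftS-cong h (here refl) = refl
    liftS-cong h (there x)   = cong (ren there) (h x)

  mutual
    sub-ren : ∀ {b Γ Δ Ξ σ} (θ : Subst b Δ Ξ) (ρ : Ren Γ Δ) (t : Tm b Γ σ) →
              sub θ (ren ρ t) ≡ sub (λ x → θ (ρ x)) t
    sub-ren θ ρ (bvar x)      = refl
    sub-ren θ ρ (fvar n)      = refl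
    sub-ren θ ρ (con f)       = refl
    sub-ren θ ρ (app s t)     = cong₂ app (sub-ren θ ρ s) (sub-ren θ ρ t)
    sub-ren θ ρ (lam s)       = cong lam (trans (sub-ren (liftS θ) (liftR ρ) s) (sub-cong lift-comm s))
      where lift-comm : ∀ {a} x → liftS θ (liftR ρ {a} x) ≡ liftS (λ y → θ (ρ y)) x
            lift-comm (here refl) = refl
            lift-comm (there x)   = refl
    sub-ren θ ρ (meta Z p ts) = cong (meta Z p) (subA-ren θ ρ ts)

    subA-ren : ∀ {b Γ Δ Ξ as} (θ : Subst b Δ Ξ) (ρ : Ren Γ Δ) (ts : Args b Γ as) →
               subA θ (renA ρ ts) ≡ subA (λ x → θ (ρ x)) ts
    subA-ren θ ρ []       = refl
    subA-ren θ ρ (t ∷ ts) = cong₂ _∷_ (sub-ren θ ρ t) (subA-ren θ ρ ts)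

  mutual
    ren-sub : ∀ {b Γ Δ Ξ σ} (ρ : Ren Δ Ξ) (θ : Subst b Γ Δ) (t : Tm b Γ σ) →
              ren ρ (sub θ t) ≡ sub (λ x → ren ρ (θ x)) t
    ren-sub ρ θ (bvar x)      = refl
    ren-sub ρ θ (fvar n)      = refl
    ren-sub ρ θ (con f)       = refl
    ren-sub ρ θ (app s t)     = cong₂ app (ren-sub ρ θ s) (ren-sub ρ θ t)
    ren-sub ρ θ (lam s)       = cong lam (trans (ren-sub (liftR ρ) (liftS θ) s) (sub-cong lift-comm s))
      where lift-comm : ∀ {a} x → ren (liftR ρ) (liftS θ {a} x) ≡ liftS (λ y → ren ρ (θ y)) x
            lift-comm (here refl) = refl
            lift-comm (there x)   = trans (ren-∘ (liftR ρ) there (θ x)) (sym (ren-∘ there ρ (θ x)))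
    ren-sub ρ θ (meta Z p ts) = cong (meta Z p) (renA-sub ρ θ ts)

    renA-sub : ∀ {b Γ Δ Ξ as} (ρ : Ren Δ Ξ) (θ : Subst b Γ Δ) (ts : Args b Γ as) →
               renA ρ (subA θ ts) ≡ subA (λ x → ren ρ (θ x)) ts
    renA-sub ρ θ []       = refl
    renA-sub ρ θ (t ∷ ts) = cong₂ _∷_ (ren-sub ρ θ t) (renA-sub ρ θ ts)

  ren-sub0 : ∀ {b Γ Δ σ τ} (ρ : Ren Γ Δ) (v : Tm b Γ σ) (u : Tm b (σ ∷ Γ) τ) →
             ren ρ (sub0 v u) ≡ sub0 (ren ρ v) (ren (liftR ρ) u)
  ren-sub0 ρ v u = trans (ren-sub ρ (ext bvar v) u)
                     (trans (sub-cong ext-comm u) (sym (sub-ren (ext bvar (ren ρ v)) (liftR ρ) u)))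
    where ext-comm : ∀ {a} x → ren ρ (ext bvar v {a} x) ≡ ext bvar (ren ρ v) (liftR ρ x)
          ext-comm (here refl) = refl
          ext-comm (there x)   = refl

  ren-apps : ∀ {b Γ Δ as τ} (ρ : Ren Γ Δ) (t : Tm b Γ (as ⇒* τ)) (ss : Args b Γ as) →
             ren ρ (apps t ss) ≡ apps (ren ρ t) (renA ρ ss)
  ren-apps ρ t []       = refl
  ren-apps ρ t (s ∷ ss) = ren-apps ρ (app t s) ss

  ext-cong : ∀ {b Γ Δ σ} {θ θ' : Subst b Γ Δ} (s : Tm b Δ σ) → (∀ {a} (x : a ∈ Γ) → θ x ≡ θ' x) →
             ∀ {a} (x : a ∈ σ ∷ Γ) → ext θ s x ≡ ext θ' s x
  ext-cong s h (here refl) = refl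
  ext-cong s h (there x)   = h x

  inst-cong : ∀ {Θ Ψ as τ} (t : Term Θ (as ⇒* τ)) {θ θ' : Subst false Θ Ψ} →
              (∀ {a} (x : a ∈ Θ) → θ x ≡ θ' x) → (ss : Args false Ψ as) → inst t θ ss ≡ inst t θ' ss
  inst-cong {as = []}    t h []       = sub-cong h t
  inst-cong {as = _ ∷ _} t h (s ∷ ss) with lamView t
  ... | isLam u = inst-cong u (ext-cong s h) ss
  ... | notLam  = cong (λ z → apps z (s ∷ ss)) (sub-cong h t)

  ren-inst : ∀ {Θ Ψ Ψ' as τ} (t : Term Θ (as ⇒* τ)) (θ : Subst false Θ Ψ) (ρ : Ren Ψ Ψ')
             (ss : Args false Ψ as) → ren ρ (inst t θ ss) ≡ inst t (λ x → ren ρ (θ x)) (renA ρ ss)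
  ren-inst {as = []}    t θ ρ []       = ren-sub ρ θ t
  ren-inst {as = _ ∷ _} t θ ρ (s ∷ ss) with lamView t
  ... | isLam u = trans (ren-inst u (ext θ s) ρ ss) (inst-cong u ren-ext (renA ρ ss))
    where ren-ext : ∀ {c} x → ren ρ (ext θ s {c} x) ≡ ext (λ y → ren ρ (θ y)) (ren ρ s) x
          ren-ext (here refl) = refl
          ren-ext (there x)   = refl
  ... | notLam = trans (ren-apps ρ (sub θ t) (s ∷ ss)) (cong (λ z → apps z (ren ρ s ∷ renA ρ ss)) (ren-sub ρ θ t))

  -- Unlike lamView, this view remembers that t is no abstraction, so inst-ren can see that
  -- renaming does not change the branch inst takes.
  data NotLam {b Γ} : ∀ {π} → Tm b Γ π → Set where
    nl-bvar : ∀ {π} {x : π ∈ Γ} → NotLam (bvar x)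
    nl-fvar : ∀ {π n} → NotLam (fvar {σ = π} n)
    nl-con  : ∀ {f} → NotLam (con f)
    nl-app  : ∀ {σ τ} {f : Tm b Γ (σ ⇒ τ)} {x} → NotLam (app f x)
    nl-meta : ∀ {Z p} {ts : Args b Γ (margs Z)} → NotLam (meta Z p ts)

  data LamOrNot {b Γ} : ∀ {π} → Tm b Γ π → Set where
    is-lam  : ∀ {σ τ} (u : Tm b (σ ∷ Γ) τ) → LamOrNot (lam u)
    not-lam : ∀ {π} {t : Tm b Γ π} → NotLam t → LamOrNot t

  lamOrNot : ∀ {b Γ π} (t : Tm b Γ π) → LamOrNot t
  lamOrNot (bvar x)      = not-lam nl-bvar
  lamOrNot (fvar n)      = not-lam nl-fvar
  lamOrNot (con f)       = not-lam nl-con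
  lamOrNot (app f x)     = not-lam nl-app
  lamOrNot (lam u)       = is-lam u
  lamOrNot (meta Z p ts) = not-lam nl-meta

  ren-notLam : ∀ {b Γ Δ π} {t : Tm b Γ π} (ρ : Ren Γ Δ) → NotLam t → NotLam (ren ρ t)
  ren-notLam ρ nl-bvar = nl-bvar
  ren-notLam ρ nl-fvar = nl-fvar
  ren-notLam ρ nl-con  = nl-con
  ren-notLam ρ nl-app  = nl-app
  ren-notLam ρ nl-meta = nl-meta

  lamView-notLam : ∀ {b Γ π} {t : Tm b Γ π} → NotLam t → lamView t ≡ notLam
  lamView-notLam nl-bvar = refl
  lamView-notLam nl-fvar = refl
  lamView-notLam nl-con  = refl
  lamView-notLam nl-app  = refl
  lamView-notLam nl-meta = refl

  inst-notLam : ∀ {Θ Ψ a as τ} {t : Term Θ (a ⇒ (as ⇒* τ))} (θ : Subst false Θ Ψ) (ss : Args false Ψ (a ∷ as)) →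
                NotLam t → inst t θ ss ≡ apps (sub θ t) ss
  inst-notLam θ (_ ∷ _) nl rewrite lamView-notLam nl = refl

  inst-ren : ∀ {Θ Θ' Ψ as τ} (t : Term Θ (as ⇒* τ)) (ρ : Ren Θ Θ') (θ : Subst false Θ' Ψ)
             (ss : Args false Ψ as) → inst (ren ρ t) θ ss ≡ inst t (λ x → θ (ρ x)) ss
  inst-ren {as = []}    t ρ θ []       = sub-ren θ ρ t
  inst-ren {as = _ ∷ _} t ρ θ (s ∷ ss) with lamOrNot t
  ... | is-lam u = trans (inst-ren u (liftR ρ) (ext θ s) ss) (inst-cong u ext-lift ss)
    where ext-lift : ∀ {c} x → ext θ s (liftR ρ {c} x) ≡ ext (λ y → θ (ρ y)) s x
          ext-lift (here refl) = refl
          ext-lift (there x)   = refl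
  ... | not-lam nl = begin
    inst (ren ρ t) θ (s ∷ ss)           ≡⟨ inst-notLam θ (s ∷ ss) (ren-notLam ρ nl) ⟩
    apps (sub θ (ren ρ t)) (s ∷ ss)     ≡⟨ cong (λ z → apps z (s ∷ ss)) (sub-ren θ ρ t) ⟩
    apps (sub (λ x → θ (ρ x)) t) (s ∷ ss) ≡⟨ sym (inst-notLam _ (s ∷ ss) nl) ⟩
    inst t (λ x → θ (ρ x)) (s ∷ ss)     ∎
    where open ≡-Reasoning

  liftRs : ∀ (Δ : Ctx) {Γ Γ'} → Ren Γ Γ' → Ren (Δ ++ Γ) (Δ ++ Γ')
  liftRs []      ρ x = ρ x
  liftRs (_ ∷ Δ) ρ x = liftR (liftRs Δ ρ) x

  liftRs-++⁺ˡ : ∀ (Δ : Ctx) {Γ Γ'} (ρ : Ren Γ Γ') {a} (x : a ∈ Δ) →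
                liftRs Δ ρ (∈-++⁺ˡ {ys = Γ} x) ≡ ∈-++⁺ˡ x
  liftRs-++⁺ˡ (_ ∷ Δ) ρ (here p)  = refl
  liftRs-++⁺ˡ (_ ∷ Δ) ρ (there x) = cong there (liftRs-++⁺ˡ Δ ρ x)

  liftRs-++⁺ʳ : ∀ (Δ : Ctx) {Γ Γ'} (ρ : Ren Γ Γ') {a} (x : a ∈ Γ) →
                liftRs Δ ρ (∈-++⁺ʳ Δ x) ≡ ∈-++⁺ʳ Δ (ρ x)
  liftRs-++⁺ʳ []      ρ x = refl
  liftRs-++⁺ʳ (_ ∷ Δ) ρ x = cong there (liftRs-++⁺ʳ Δ ρ x)

  mutual
    ren-msub : ∀ {Δ Γ Γ' τ} (s : MTerm Δ τ) (γ : MSub Γ) (ρ : Ren Γ Γ') →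
               ren (liftRs Δ ρ) (msub s γ) ≡ msub s (λ Z → ren ρ (γ Z))
    ren-msub {Δ} (bvar x) γ ρ = cong bvar (liftRs-++⁺ˡ Δ ρ x)
    ren-msub (fvar n)  γ ρ = refl
    ren-msub (con f)   γ ρ = refl
    ren-msub (app s t) γ ρ = cong₂ app (ren-msub s γ ρ) (ren-msub t γ ρ)
    ren-msub (lam s)   γ ρ = cong lam (ren-msub s γ ρ)
    ren-msub {Δ} (meta Z p ts) γ ρ = begin
      ren (liftRs Δ ρ) (inst (γ Z) (λ x → bvar (∈-++⁺ʳ Δ x)) (msubA ts γ))
        ≡⟨ ren-inst (γ Z) _ (liftRs Δ ρ) (msubA ts γ) ⟩
      inst (γ Z) (λ x → bvar (liftRs Δ ρ (∈-++⁺ʳ Δ x))) (renA (liftRs Δ ρ) (msubA ts γ))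
        ≡⟨ inst-cong (γ Z) (λ x → cong bvar (liftRs-++⁺ʳ Δ ρ x)) _ ⟩
      inst (γ Z) (λ x → bvar (∈-++⁺ʳ Δ (ρ x))) (renA (liftRs Δ ρ) (msubA ts γ))
        ≡⟨ cong (inst (γ Z) _) (renA-msubA ts γ ρ) ⟩
      inst (γ Z) (λ x → bvar (∈-++⁺ʳ Δ (ρ x))) (msubA ts (λ Z → ren ρ (γ Z)))
        ≡⟨ sym (inst-ren (γ Z) ρ _ _) ⟩
      inst (ren ρ (γ Z)) (λ x → bvar (∈-++⁺ʳ Δ x)) (msubA ts (λ Z → ren ρ (γ Z))) ∎
      where open ≡-Reasoning

    renA-msubA : ∀ {Δ Γ Γ' as} (ts : Args true Δ as) (γ : MSub Γ) (ρ : Ren Γ Γ') →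
                renA (liftRs Δ ρ) (msubA ts γ) ≡ msubA ts (λ Z → ren ρ (γ Z))
    renA-msubA []       γ ρ = refl
    renA-msubA (t ∷ ts) γ ρ = cong₂ _∷_ (ren-msub t γ ρ) (renA-msubA ts γ ρ)

  prefixR : ∀ {Δ Δ' Γ} → Ren Δ Δ' → Ren (Δ ++ Γ) (Δ' ++ Γ)
  prefixR {Δ} {Δ'} ρ x = [ (λ y → ∈-++⁺ˡ (ρ y)) , ∈-++⁺ʳ Δ' ]′ (∈-++⁻ Δ x)

  prefixR-++⁺ˡ : ∀ {Δ Δ' Γ} (ρ : Ren Δ Δ') {a} (x : a ∈ Δ) →
                 prefixR {Γ = Γ} ρ (∈-++⁺ˡ x) ≡ ∈-++⁺ˡ (ρ x)
  prefixR-++⁺ˡ {Δ} ρ x = cong [ _ , _ ]′ (++⁻∘++⁺ Δ (inj₁ x))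

  prefixR-++⁺ʳ : ∀ {Δ Δ' Γ} (ρ : Ren Δ Δ') {a} (x : a ∈ Γ) → prefixR ρ (∈-++⁺ʳ Δ x) ≡ ∈-++⁺ʳ Δ' x
  prefixR-++⁺ʳ {Δ} ρ x = cong [ _ , _ ]′ (++⁻∘++⁺ Δ (inj₂ x))

  prefixR-liftR : ∀ {Δ Δ' Γ σ} (ρ : Ren Δ Δ') {a} (x : a ∈ (σ ∷ Δ) ++ Γ) →
                  prefixR (liftR ρ) x ≡ liftR (prefixR ρ) x
  prefixR-liftR         ρ (here p)  = refl
  prefixR-liftR {Δ} ρ (there x) with ∈-++⁻ Δ x
  ... | inj₁ y = refl
  ... | inj₂ y = refl

  mutual
    msub-ren : ∀ {Δ Δ' Γ τ} (ρ : Ren Δ Δ') (s : MTerm Δ τ) (γ : MSub Γ) →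
               msub (ren ρ s) γ ≡ ren (prefixR ρ) (msub s γ)
    msub-ren ρ (bvar x)  γ = cong bvar (sym (prefixR-++⁺ˡ ρ x))
    msub-ren ρ (fvar n)  γ = refl
    msub-ren ρ (con f)   γ = refl
    msub-ren ρ (app s t) γ = cong₂ app (msub-ren ρ s γ) (msub-ren ρ t γ)
    msub-ren ρ (lam s)   γ = cong lam (trans (msub-ren (liftR ρ) s γ) (ren-cong (prefixR-liftR ρ) (msub s γ)))
    msub-ren {Δ} {Δ'} ρ (meta Z p ts) γ = begin
      inst (γ Z) (λ x → bvar (∈-++⁺ʳ Δ' x)) (msubA (renA ρ ts) γ)
        ≡⟨ cong (inst (γ Z) _) (msubA-renA ρ ts γ) ⟩
      inst (γ Z) (λ x → bvar (∈-++⁺ʳ Δ' x)) (renA (prefixR ρ) (msubA ts γ))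
        ≡⟨ inst-cong (γ Z) (λ x → cong bvar (sym (prefixR-++⁺ʳ ρ x))) _ ⟩
      inst (γ Z) (λ x → bvar (prefixR ρ (∈-++⁺ʳ Δ x))) (renA (prefixR ρ) (msubA ts γ))
        ≡⟨ sym (ren-inst (γ Z) _ (prefixR ρ) (msubA ts γ)) ⟩
      ren (prefixR ρ) (inst (γ Z) (λ x → bvar (∈-++⁺ʳ Δ x)) (msubA ts γ)) ∎
      where open ≡-Reasoning

    msubA-renA : ∀ {Δ Δ' Γ as} (ρ : Ren Δ Δ') (ts : Args true Δ as) (γ : MSub Γ) →
                msubA (renA ρ ts) γ ≡ renA (prefixR ρ) (msubA ts γ)
    msubA-renA ρ []       γ = refl
    msubA-renA ρ (t ∷ ts) γ = cong₂ _∷_ (msub-ren ρ t γ) (msubA-renA ρ ts γ)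

  ▷⇒⊵ : ∀ {b Γ σ Δ τ} {s : Tm b Γ σ} {t : Tm b Δ τ} → s ▷ t → s ⊵ t
  ▷⇒⊵ (▷lam p)  = ⊵lam p
  ▷⇒⊵ (▷appl p) = ⊵appl p
  ▷⇒⊵ (▷appr p) = ⊵appr p

  ⊵-trans : ∀ {b Γ σ Δ τ Ξ π} {s : Tm b Γ σ} {t : Tm b Δ τ} {u : Tm b Ξ π} → s ⊵ t → t ⊵ u → s ⊵ u
  ⊵-trans ⊵here     q = q
  ⊵-trans (⊵lam p)  q = ⊵lam (⊵-trans p q)
  ⊵-trans (⊵appl p) q = ⊵appl (⊵-trans p q)
  ⊵-trans (⊵appr p) q = ⊵appr (⊵-trans p q)

  ⊵-▷-trans : ∀ {b Γ σ Δ τ Ξ π} {s : Tm b Γ σ} {t : Tm b Δ τ} {u : Tm b Ξ π} → s ⊵ t → t ▷ u → s ▷ u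
  ⊵-▷-trans ⊵here     q = q
  ⊵-▷-trans (⊵lam p)  q = ▷lam (⊵-trans p (▷⇒⊵ q))
  ⊵-▷-trans (⊵appl p) q = ▷appl (⊵-trans p (▷⇒⊵ q))
  ⊵-▷-trans (⊵appr p) q = ▷appr (⊵-trans p (▷⇒⊵ q))

  size : ∀ {b Γ σ} → Tm b Γ σ → ℕ
  size (app f x) = suc (size f + size x)
  size (lam u)   = suc (size u)
  size _         = 1

  ⊵⇒size≤ : ∀ {b Γ σ Δ τ} {s : Tm b Γ σ} {t : Tm b Δ τ} → s ⊵ t → size t ≤ size s
  ⊵⇒size≤ ⊵here = ≤-refl
  ⊵⇒size≤ (⊵lam p) = m≤n⇒m≤1+n (⊵⇒size≤ p)
  ⊵⇒size≤ {s = app f x} (⊵appl p) = m≤n⇒m≤1+n (≤-trans (⊵⇒size≤ p) (m≤m+n (size f) (size x)))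
  ⊵⇒size≤ {s = app f x} (⊵appr p) = m≤n⇒m≤1+n (≤-trans (⊵⇒size≤ p) (m≤n+m (size x) (size f)))

  ▷⇒size< : ∀ {b Γ σ Δ τ} {s : Tm b Γ σ} {t : Tm b Δ τ} → s ▷ t → size t < size s
  ▷⇒size< (▷lam p) = s≤s (⊵⇒size≤ p)
  ▷⇒size< {s = app f x} (▷appl p) = s≤s (≤-trans (⊵⇒size≤ p) (m≤m+n (size f) (size x)))
  ▷⇒size< {s = app f x} (▷appr p) = s≤s (≤-trans (⊵⇒size≤ p) (m≤n+m (size x) (size f)))

  ren-⊵ : ∀ {b Γ Γ' σ Δ τ} (ρ : Ren Γ Γ') {s : Tm b Γ σ} {t : Tm b Δ τ} → s ⊵ t →
          Σ Ctx λ Δ' → Σ (Ren Δ Δ') λ ρ' → ren ρ s ⊵ ren ρ' t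
  ren-⊵ ρ ⊵here = _ , ρ , ⊵here
  ren-⊵ ρ (⊵lam p)  with ren-⊵ (liftR ρ) p
  ... | Δ' , ρ' , q = Δ' , ρ' , ⊵lam q
  ren-⊵ ρ (⊵appl p) with ren-⊵ ρ p
  ... | Δ' , ρ' , q = Δ' , ρ' , ⊵appl q
  ren-⊵ ρ (⊵appr p) with ren-⊵ ρ p
  ... | Δ' , ρ' , q = Δ' , ρ' , ⊵appr q

  ren-▷ : ∀ {b Γ Γ' σ Δ τ} (ρ : Ren Γ Γ') {s : Tm b Γ σ} {t : Tm b Δ τ} → s ▷ t →
          Σ Ctx λ Δ' → Σ (Ren Δ Δ') λ ρ' → ren ρ s ▷ ren ρ' t
  ren-▷ ρ (▷lam p)  with ren-⊵ (liftR ρ) p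
  ... | Δ' , ρ' , q = Δ' , ρ' , ▷lam q
  ren-▷ ρ (▷appl p) with ren-⊵ ρ p
  ... | Δ' , ρ' , q = Δ' , ρ' , ▷appl q
  ren-▷ ρ (▷appr p) with ren-⊵ ρ p
  ... | Δ' , ρ' , q = Δ' , ρ' , ▷appr q

  msub-⊵ : ∀ {Δ σ Δ' τ Γ} {s : MTerm Δ σ} {t : MTerm Δ' τ} (γ : MSub Γ) → s ⊵ t → msub s γ ⊵ msub t γ
  msub-⊵ γ ⊵here     = ⊵here
  msub-⊵ γ (⊵lam p)  = ⊵lam (msub-⊵ γ p)
  msub-⊵ γ (⊵appl p) = ⊵appl (msub-⊵ γ p)
  msub-⊵ γ (⊵appr p) = ⊵appr (msub-⊵ γ p)

  msub-▷ : ∀ {Δ σ Δ' τ Γ} {s : MTerm Δ σ} {t : MTerm Δ' τ} (γ : MSub Γ) → s ▷ t → msub s γ ▷ msub t γ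
  msub-▷ γ (▷lam p)  = ▷lam (msub-⊵ γ p)
  msub-▷ γ (▷appl p) = ▷appl (msub-⊵ γ p)
  msub-▷ γ (▷appr p) = ▷appr (msub-⊵ γ p)

  OpenTerm : Set
  OpenTerm = Σ Ctx λ Γ → Σ Type (Term Γ)

  ⌜_⌝ : ∀ {Γ σ} → Term Γ σ → OpenTerm
  ⌜ t ⌝ = _ , _ , t

  renP : ∀ {Ξ} → Ren [] Ξ → Σ Type (Term []) → OpenTerm
  renP {Ξ} ρ (σ , t) = Ξ , σ , ren ρ t

  terminating-mono : ∀ {R U : Rule → Set} → (∀ {Γ σ} {s t : Term Γ σ} → Step R s t → Step U s t) →
                     ∀ {Γ σ} {t : Term Γ σ} → Terminating U t → Terminating R t
  terminating-mono R⊆U (acc rs) = acc λ st → terminating-mono R⊆U (rs (R⊆U st))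

  module ReductionOrder (R : Rule → Set) where

    ren-step : ∀ {Γ Δ σ} (ρ : Ren Γ Δ) {s t : Term Γ σ} → Step R s t → Step R (ren ρ s) (ren ρ t)
    ren-step ρ (rule r r∈R δ) =
      subst₂ (Step R) (sym (ren-msub (Rule.lhs r) δ ρ)) (sym (ren-msub (Rule.rhs r) δ ρ)) (rule r r∈R (λ Z → ren ρ (δ Z)))
    ren-step ρ (beta {u = u} {v}) = subst (Step R _) (sym (ren-sub0 ρ v u)) beta
    ren-step ρ (appL st) = appL (ren-step ρ st)
    ren-step ρ (appR st) = appR (ren-step ρ st)
    ren-step ρ (lamC st) = lamC (ren-step (liftR ρ) st)

    ren-steps : ∀ {Γ Δ σ} (ρ : Ren Γ Δ) {s t : Term Γ σ} → Steps R s t → Steps R (ren ρ s) (ren ρ t)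
    ren-steps ρ ε          = ε
    ren-steps ρ (st ◅ sts) = ren-step ρ st ◅ ren-steps ρ sts

    ⊵-step : ∀ {Γ σ Δ τ} {s : Term Γ σ} {t t' : Term Δ τ} → s ⊵ t → Step R t t' →
             Σ (Term Γ σ) λ s' → Step R s s' × s' ⊵ t'
    ⊵-step ⊵here st = _ , st , ⊵here
    ⊵-step (⊵lam p) st with ⊵-step p st
    ... | _ , st' , q = _ , lamC st' , ⊵lam q
    ⊵-step (⊵appl p) st with ⊵-step p st
    ... | _ , st' , q = _ , appL st' , ⊵appl q
    ⊵-step (⊵appr p) st with ⊵-step p st
    ... | _ , st' , q = _ , appR st' , ⊵appr q

    infix 4 _⊏_ _⊏⁺_ _⊏*_

    data _⊏_ : OpenTerm → OpenTerm → Set where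
      reduct  : ∀ {Γ σ} {s t : Term Γ σ} → Step R s t → ⌜ t ⌝ ⊏ ⌜ s ⌝
      subterm : ∀ {Γ σ Δ τ} {s : Term Γ σ} {t : Term Δ τ} → s ▷ t → ⌜ t ⌝ ⊏ ⌜ s ⌝

    _⊏⁺_ : OpenTerm → OpenTerm → Set
    _⊏⁺_ = TransClosure _⊏_

    _⊏*_ : OpenTerm → OpenTerm → Set
    _⊏*_ = Star _⊏_

    -- Lexicographic in the termination of s and the size of t: a reduction of t is mirrored in s.
    mutual
      ⊵-acc : ∀ {Γ σ Δ τ} {s : Term Γ σ} {t : Term Δ τ} →
              Terminating R s → Acc _<_ (size t) → s ⊵ t → Acc _⊏_ ⌜ t ⌝
      ⊵-acc s↓ size↓ s⊵t = acc (⊵-acc-⊏ s↓ size↓ s⊵t)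

      ⊵-acc-⊏ : ∀ {Γ σ Δ τ} {s : Term Γ σ} {t : Term Δ τ} →
                Terminating R s → Acc _<_ (size t) → s ⊵ t → ∀ {u} → u ⊏ ⌜ t ⌝ → Acc _⊏_ u
      ⊵-acc-⊏ (acc s↓) _ s⊵t (reduct st) with ⊵-step s⊵t st
      ... | _ , st' , s'⊵t' = ⊵-acc (s↓ st') (<-wellFounded _) s'⊵t'
      ⊵-acc-⊏ s↓ (acc size↓) s⊵t (subterm t▷u) = ⊵-acc s↓ (size↓ (▷⇒size< t▷u))
          (▷⇒⊵ (⊵-▷-trans s⊵t t▷u))

    terminating⇒acc-⊏⁺ : ∀ {Γ σ} {t : Term Γ σ} → Terminating R t → Acc _⊏⁺_ ⌜ t ⌝
    terminating⇒acc-⊏⁺ t↓ = Plus.accessible _⊏_ (⊵-acc t↓ (<-wellFounded _) ⊵here)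

    steps⇒⊏* : ∀ {Γ σ} {s t : Term Γ σ} → Steps R s t → ⌜ t ⌝ ⊏* ⌜ s ⌝
    steps⇒⊏* ε          = ε
    steps⇒⊏* (st ◅ sts) = steps⇒⊏* sts ◅◅ (reduct st ◅ ε)

    ⊏-⊏*⇒⊏⁺ : ∀ {x y z} → x ⊏ y → y ⊏* z → x ⊏⁺ z
    ⊏-⊏*⇒⊏⁺ p ε       = Plus.[ p ]
    ⊏-⊏*⇒⊏⁺ p (q ◅ qs) = p ∷ ⊏-⊏*⇒⊏⁺ q qs

  head-msub : ∀ {Δ Γ σ} (p : MTerm Δ σ) (γ : MSub Γ) {g} → headSym p ≡ just g → headSym (msub p γ) ≡ just g
  head-msub (con f)   γ e = e
  head-msub (app f x) γ e = head-msub f γ e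
  head-msub (bvar x)      γ ()
  head-msub (fvar n)      γ ()
  head-msub (lam u)       γ ()
  head-msub (meta Z p ts) γ ()

  msubP : ∀ {Δ Γ} → MSub Γ → Σ Type (MTerm Δ) → Σ Type (Term (Δ ++ Γ))
  msubP γ (σ , u) = σ , msub u γ

  args-msub : ∀ {Δ Γ σ} (p : MTerm Δ σ) (γ : MSub Γ) {g} → headSym p ≡ just g →
              args (msub p γ) ≡ map (msubP γ) (args p)
  args-msub (con f)   γ e = refl
  args-msub (app f x) γ e = trans (cong (_++ _) (args-msub f γ e)) (sym (map-++ (msubP γ) (args f) _))
  args-msub (bvar x)      γ ()
  args-msub (fvar n)      γ ()
  args-msub (lam u)       γ ()
  args-msub (meta Z p ts) γ ()

  nth1-map : ∀ {A B : Set} (g : A → B) (xs : List A) j → nth1 (map g xs) j ≡ Maybe.map g (nth1 xs j)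
  nth1-map g []       j             = refl
  nth1-map g (x ∷ xs) zero          = refl
  nth1-map g (x ∷ xs) (suc zero)    = refl
  nth1-map g (x ∷ xs) (suc (suc n)) = nth1-map g xs (suc n)

  nth1-∷ʳ : ∀ {A : Set} (xs : List A) (y z : A) j → nth1 (xs ++ [ y ]) j ≡ just z → nth1 xs j ≡ just z ⊎ z ≡ y
  nth1-∷ʳ []       y z (suc zero)    refl = inj₂ refl
  nth1-∷ʳ []       y z (suc (suc n)) ()
  nth1-∷ʳ (x ∷ xs) y z (suc zero)    e    = inj₁ e
  nth1-∷ʳ (x ∷ xs) y z (suc (suc n)) e    = nth1-∷ʳ xs y z (suc n) e

  nth1-args⇒ArgOf : ∀ {b Γ σ τ} (t : Tm b Γ σ) {v : Tm b Γ τ} j → nth1 (args t) j ≡ just (τ , v) → ArgOf t v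
  nth1-args⇒ArgOf (app f x) j e with nth1-∷ʳ (args f) _ _ j e
  ... | inj₁ e'   = ao-left (nth1-args⇒ArgOf f j e')
  ... | inj₂ refl = ao-here
  nth1-args⇒ArgOf (bvar x)      j ()
  nth1-args⇒ArgOf (fvar n)      j ()
  nth1-args⇒ArgOf (con f)       j ()
  nth1-args⇒ArgOf (lam u)       j ()
  nth1-args⇒ArgOf (meta Z p ts) j ()

  ArgOf⇒▷ : ∀ {b Γ σ τ} {t : Tm b Γ σ} {v : Tm b Γ τ} → ArgOf t v → t ▷ v
  ArgOf⇒▷ ao-here     = ▷appr ⊵here
  ArgOf⇒▷ (ao-left p) = ▷appl (▷⇒⊵ (ArgOf⇒▷ p))

  Pointwise-nth1 : ∀ {A : Set} {P : A → A → Set} {xs ys : List A} → Pointwise P xs ys →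
                   ∀ j {x} → nth1 xs j ≡ just x → Σ A λ y → nth1 ys j ≡ just y × P x y
  Pointwise-nth1 (p ∷ ps) (suc zero)    refl = _ , refl , p
  Pointwise-nth1 (p ∷ ps) (suc (suc n)) e    = Pointwise-nth1 ps (suc n) e

  data ArgSteps (R : Rule → Set) {Γ} : Σ Type (Term Γ) → Σ Type (Term Γ) → Set where
    argSteps : ∀ {σ} {u w : Term Γ σ} → Steps R u w → ArgSteps R (σ , u) (σ , w)

  ArgRed⇒Pointwise : ∀ {R Γ σ} {t s : Term Γ σ} → ArgRed R t s →
                     headSym t ≡ headSym s × Pointwise (ArgSteps R) (args t) (args s)
  ArgRed⇒Pointwise ar-head = refl , []
  ArgRed⇒Pointwise (ar-app r sts) with ArgRed⇒Pointwise r
  ... | h , ps = h , ++⁺ ps (argSteps sts ∷ [])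

  record Projects {b Γ σ} (ν : Sym → ℕ) (t : Tm b Γ σ) (u : Σ Type (Tm b Γ)) : Set where
    constructor projects
    field
      head    : Sym
      head-eq : headSym t ≡ just head
      arg-eq  : nth1 (args t) (ν head) ≡ just u

  module _ {ν : Sym → ℕ} where

    proj⇒Projects : ∀ {σ} (p : MTerm [] σ) {u} → proj ν p ≡ just u → Projects ν p u
    proj⇒Projects p e with headSym p in head-eq
    ... | just g = projects g head-eq e

    Projects-msub : ∀ {Δ Γ σ} {p : MTerm Δ σ} (γ : MSub Γ) {u} → Projects ν p u → Projects ν (msub p γ) (msubP γ u)
    Projects-msub {p = p} γ {u} (projects g hg ng) = projects g (head-msub p γ hg) arg-eq
      where
        open ≡-Reasoning
        arg-eq : nth1 (args (msub p γ)) (ν g) ≡ just (msubP γ u)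
        arg-eq = begin
          nth1 (args (msub p γ)) (ν g)          ≡⟨ cong (λ l → nth1 l (ν g)) (args-msub p γ hg) ⟩
          nth1 (map (msubP γ) (args p)) (ν g)   ≡⟨ nth1-map (msubP γ) (args p) (ν g) ⟩
          Maybe.map (msubP γ) (nth1 (args p) (ν g)) ≡⟨ cong (Maybe.map (msubP γ)) ng ⟩
          just (msubP γ u)                      ∎

    Projects-functional : ∀ {b Γ σ} {t : Tm b Γ σ} {u u'} → Projects ν t u → Projects ν t u' → u ≡ u'
    Projects-functional (projects g hg ng) (projects g' hg' ng') with trans (sym hg) hg'
    ... | refl = just-injective (trans (sym ng) ng')

    Projects-subst : ∀ {σ τ} (e : σ ≡ τ) {t : Term [] σ} {u} → Projects ν t u → Projects ν (subst (Term []) e t) u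
    Projects-subst refl pr = pr

    Projects-ArgRed : ∀ {R Γ σ} {t s : Term Γ σ} {u} → ArgRed R t s → Projects ν t u →
                      Σ (Σ Type (Term Γ)) λ w → Projects ν s w × ArgSteps R u w
    Projects-ArgRed r (projects g hg ng) with ArgRed⇒Pointwise r
    ... | hts , ps with Pointwise-nth1 ps (ν g) ng
    ... | w , nw , uw = w , projects g (trans (sym hts) hg) nw , uw

    Projects⇒ArgOf : ∀ {b Γ σ τ} {t : Tm b Γ σ} {v : Tm b Γ τ} → Projects ν t (τ , v) → ArgOf t v
    Projects⇒ArgOf {t = t} (projects g _ ng) = nth1-args⇒ArgOf t (ν g) ng

  ▷c-msub : ∀ (γ : MSub []) {u v : Σ Type (MTerm [])} → u ▷c v →
            Σ Ctx λ Ξ → Σ (Ren [] Ξ) λ ρ → proj₂ (msubP γ u) ▷ ren ρ (proj₂ (msubP γ v))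
  ▷c-msub γ {_ , u} {_ , v} (Ξ , u▷v) =
    Ξ ++ [] , prefixR {Δ = []} (λ ()) , subst (msub u γ ▷_) (msub-ren (λ ()) v γ) (msub-▷ γ u▷v)

  data VarApp : ∀ {σ} → Term [] σ → Set where
    var     : ∀ {σ n} → VarApp (fvar {false} {[]} {σ} n)
    applied : ∀ {σ τ} {f : Term [] (σ ⇒ τ)} {x} → VarApp f → VarApp (app f x)

  VarApp-head : ∀ {σ} {t : Term [] σ} → VarApp t → headSym t ≡ nothing
  VarApp-head var     = refl
  VarApp-head (applied v) = VarApp-head v

  VarApp⇒Neutral : ∀ {σ} {t : Term [] σ} → VarApp t → Neutral t
  VarApp⇒Neutral var     = ne-var
  VarApp⇒Neutral (applied v) = ne-app (VarApp⇒Neutral v)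

  terminating-appˡ : ∀ {U σ τ} {t : Term [] (σ ⇒ τ)} {x} → Terminating U (app t x) → Terminating U t
  terminating-appˡ (acc rs) = acc λ st → terminating-appˡ (rs (appL st))

  data RootRedex {Γ} : ∀ {σ} → Term Γ σ → Set where
    headed  : ∀ {σ} {s : Term Γ σ} {f} → headSym s ≡ just f → RootRedex s
    β-redex : ∀ {σ τ} {u : Term (σ ∷ Γ) τ} {v} → RootRedex (app (lam u) v)

  data BelowRoot (U : Rule → Set) {Γ} : ∀ {σ} → Term Γ σ → Term Γ σ → Set where
    appL : ∀ {σ τ} {f f' : Term Γ (σ ⇒ τ)} {x} → Step U f f' → BelowRoot U (app f x) (app f' x)
    appR : ∀ {σ τ} {f : Term Γ (σ ⇒ τ)} {x x'} → Step U x x' → BelowRoot U (app f x) (app f x')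
    lamC : ∀ {σ τ} {u u' : Term (σ ∷ Γ) τ} → Step U u u' → BelowRoot U (lam u) (lam u')

  VarApp-¬RootRedex : ∀ {σ} {s : Term [] σ} → VarApp s → ¬ RootRedex s
  VarApp-¬RootRedex v (headed hf) with trans (sym (VarApp-head v)) hf
  ... | ()
  VarApp-¬RootRedex (applied ()) β-redex

  module _ {U : Rule → Set} (wfU : ∀ r → U r → WFRule r) where

    root-or-below : ∀ {Γ σ} {s t : Term Γ σ} → Step U s t → RootRedex s ⊎ BelowRoot U s t
    root-or-below (rule r r∈U δ) = inj₁ (headed (head-msub (Rule.lhs r) δ (proj₂ (WFRule.lhsHeadFun (wfU r r∈U)))))
    root-or-below beta      = inj₁ β-redex
    root-or-below (appL st) = inj₂ (appL st)
    root-or-below (appR st) = inj₂ (appR st)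
    root-or-below (lamC st) = inj₂ (lamC st)

    VarApp-step : ∀ {σ} {s t : Term [] σ} → VarApp s → Step U s t → VarApp t
    VarApp-step v st with root-or-below st
    ... | inj₁ root = ⊥-elim (VarApp-¬RootRedex v root)
    VarApp-step (applied v) st | inj₂ (appL st') = applied (VarApp-step v st')
    VarApp-step (applied v) st | inj₂ (appR st') = applied v

    VarApp-app-terminating : ∀ {σ τ} {h : Term [] (σ ⇒ τ)} {u} → VarApp h →
                             Terminating U h → Terminating U u → Terminating U (app h u)
    VarApp-app-terminating v h↓ u↓ = acc λ st → reduct-terminating v h↓ u↓ (root-or-below st)
      where
        reduct-terminating : ∀ {σ τ} {h : Term [] (σ ⇒ τ)} {u w} → VarApp h → Terminating U h → Terminating U u →
                             RootRedex (app h u) ⊎ BelowRoot U (app h u) w → Terminating U w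
        reduct-terminating v _        _        (inj₁ root)      = ⊥-elim (VarApp-¬RootRedex (applied v) root)
        reduct-terminating v (acc h↓) u↓       (inj₂ (appL st)) = VarApp-app-terminating (VarApp-step v st) (h↓ st) u↓
        reduct-terminating v h↓       (acc u↓) (inj₂ (appR st)) = VarApp-app-terminating v h↓ (u↓ st)

    var-terminating : ∀ {σ n} → Terminating U (fvar {false} {[]} {σ} n)
    var-terminating {σ} {n} = acc λ st → reduct-terminating (root-or-below st)
      where
        reduct-terminating : ∀ {w} → RootRedex (fvar {false} {[]} {σ} n) ⊎ BelowRoot U (fvar {false} {[]} {σ} n) w →
                             Terminating U w
        reduct-terminating (inj₁ root) = ⊥-elim (VarApp-¬RootRedex var root)

    module _ {I : BaseSet} (rc : IsRC U I) where
      open IsRC rc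

      mutual
        Comp⇒Terminating : ∀ σ {t : Term [] σ} → Comp I σ t → Terminating U t
        Comp⇒Terminating (base ι) c = rc-term c
        Comp⇒Terminating (σ ⇒ τ)  c = terminating-appˡ (Comp⇒Terminating τ (c (fvar 0) (VarApp-Comp σ var var-terminating)))

        VarApp-Comp : ∀ σ {h : Term [] σ} → VarApp h → Terminating U h → Comp I σ h
        VarApp-Comp (base ι) v (acc h↓) = rc-neutral (VarApp⇒Neutral v)
            (λ _ st → VarApp-Comp (base ι) (VarApp-step v st) (h↓ st))
        VarApp-Comp (σ ⇒ τ)  v h↓       = λ u cu → VarApp-Comp τ (applied v)
            (VarApp-app-terminating v h↓ (Comp⇒Terminating σ cu))

  Chain-map : ∀ {R} {P Q : DP → Set} → (∀ d → P d → Q d) → Chain R P → Chain R Q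
  Chain-map P⊆Q c = record
    { pair = pair ; inP = λ i → P⊆Q _ (inP i) ; γ = γ ; resp = resp ; tyEq = tyEq ; link = link }
    where open Chain c

  suffix : ∀ {R P} {Q : DP → Set} (c : Chain R P) (k : ℕ) → (∀ i → Q (Chain.pair c (i + k))) → Chain R Q
  suffix c k inQ = record
    { pair = λ i → pair (i + k) ; inP = inQ ; γ = λ i → γ (i + k)
    ; resp = λ i → resp (i + k) ; tyEq = λ i → tyEq (i + k) ; link = λ i → link (i + k) }
    where open Chain c

  module _ (CU : (Rule → Set) → BaseSet) {R : Rule → Set} {P Q : DP → Set}
           (c : Chain R P) (k : ℕ) (inQ : ∀ i → Q (Chain.pair c (i + k))) where

    MCond-suffix : ∀ m → MCond CU m c → MCond CU m (suffix {Q = Q} c k inQ)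
    MCond-suffix minimal        (lift min)     = lift (λ i → min (i + k))
    MCond-suffix arbitrary      _              = lift tt
    MCond-suffix (computable U) (R⊆U , comp)   = R⊆U , (λ i → comp (i + k))

    FCond-suffix : ∀ f → FCond f c → FCond f (suffix {Q = Q} c k inQ)
    FCond-suffix formative form = λ i → form (i + k)
    FCond-suffix all       _    = tt

  module Soundness (CU : (Rule → Set) → BaseSet) (CU-isCU : ∀ U → IsCU U (CU U))
                   {P R m f P₁ P₂ ν} (ap : Applicable ⟨ P , R , m , f ⟩ P₁ P₂ ν)
                   (wfM : WFProblem ⟨ P , R , m , f ⟩) (finN : Finite CU ⟨ P₂ , R , m , f ⟩)
                   (c : Chain R P) (mc : MCond CU m c) (fc : FCond f c) where
    open Chain c
    open Applicable ap
    open ReductionOrder R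

    ℓ̄ p̄ : ℕ → Σ Type (MTerm [])
    ℓ̄ i = proj₁ (proj₁ (projection (pair i) (inP i)))
    p̄ i = proj₁ (proj₂ (projection (pair i) (inP i)))

    ℓ̄-eq : ∀ i → proj ν (DP.lhs (pair i)) ≡ just (ℓ̄ i)
    ℓ̄-eq i = proj₂ (proj₁ (projection (pair i) (inP i)))

    p̄-eq : ∀ i → proj ν (DP.rhs (pair i)) ≡ just (p̄ i)
    p̄-eq i = proj₂ (proj₂ (projection (pair i) (inP i)))

    s̄ t̄ : ℕ → Σ Type (Term [])
    s̄ i = msubP (γ i) (ℓ̄ i)
    t̄ i = msubP (γ i) (p̄ i)

    s̄-Projects : ∀ i → Projects ν (s i) (s̄ i)
    s̄-Projects i = Projects-msub (γ i) (proj⇒Projects (DP.lhs (pair i)) (ℓ̄-eq i))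

    t̄-Projects : ∀ i → Projects ν (t i) (t̄ i)
    t̄-Projects i = Projects-msub (γ i) (proj⇒Projects (DP.rhs (pair i)) (p̄-eq i))

    t̄→*s̄ : ∀ i → ArgSteps R (t̄ i) (s̄ (suc i))
    t̄→*s̄ i with Projects-ArgRed (link i) (Projects-subst (tyEq i) (t̄-Projects i))
    ... | w , w-Projects , t̄→*w =
      subst (ArgSteps R (t̄ i)) (Projects-functional w-Projects (s̄-Projects (suc i))) t̄→*w

    P₂⇒s̄≡t̄ : ∀ i → P₂ (pair i) → s̄ i ≡ t̄ i
    P₂⇒s̄≡t̄ i p₂ =
      cong (msubP (γ i)) (just-injective (trans (sym (ℓ̄-eq i)) (trans (equal (pair i) p₂) (p̄-eq i))))

    P₁⇒s̄▷t̄ : ∀ i → P₁ (pair i) →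
              Σ Ctx λ Ξ → Σ (Ren [] Ξ) λ ρ → proj₂ (s̄ i) ▷ ren ρ (proj₂ (t̄ i))
    P₁⇒s̄▷t̄ i p₁ with strict (pair i) p₁
    ... | u , v , ℓ-eq , p-eq , u▷v =
      subst₂ (λ u v → Σ Ctx λ Ξ → Σ (Ren [] Ξ) λ ρ → proj₂ (msubP (γ i) u) ▷ ren ρ (proj₂ (msubP (γ i) v)))
             (just-injective (trans (sym ℓ-eq) (ℓ̄-eq i))) (just-injective (trans (sym p-eq) (p̄-eq i)))
             (▷c-msub (γ i) u▷v)

    ArgSteps⇒⊏* : ∀ {Ξ} (ρ : Ren [] Ξ) {u w} → ArgSteps R u w → renP ρ w ⊏* renP ρ u
    ArgSteps⇒⊏* ρ (argSteps sts) = steps⇒⊏* (ren-steps ρ sts)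

    P₂-⊏* : ∀ k {Ξ} (ρ : Ren [] Ξ) → P₂ (pair (suc k)) → renP ρ (t̄ (suc k)) ⊏* renP ρ (t̄ k)
    P₂-⊏* k ρ p₂ = subst (λ x → renP ρ x ⊏* renP ρ (t̄ k))
      (P₂⇒s̄≡t̄ (suc k) p₂) (ArgSteps⇒⊏* ρ (t̄→*s̄ k))

    P₁-⊏⁺ : ∀ {y} k {Ξ} (ρ : Ren [] Ξ) → renP ρ (t̄ k) ⊏* y → P₁ (pair (suc k)) →
            Σ Ctx λ Ξ' → Σ (Ren [] Ξ') λ ρ' → renP ρ' (t̄ (suc k)) ⊏⁺ y
    P₁-⊏⁺ k ρ r p₁ with P₁⇒s̄▷t̄ (suc k) p₁
    ... | _ , ρ₁ , s̄▷t̄ with ren-▷ ρ s̄▷t̄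
    ... | Ξ' , ρ₂ , s̄▷t̄' =
      Ξ' , (λ x → ρ₂ (ρ₁ x)) ,
      ⊏-⊏*⇒⊏⁺ (subterm (subst (ren ρ (proj₂ (s̄ (suc k))) ▷_) (ren-∘ ρ₂ ρ₁ _) s̄▷t̄'))
              (ArgSteps⇒⊏* ρ (t̄→*s̄ k) ◅◅ r)

    P₁-recurs : ∀ k → ¬ ¬ Σ ℕ λ j → P₁ (pair (j + k))
    P₁-recurs k no-P₁ =
      finN (suffix c k inP₂ , MCond-suffix CU c k inP₂ m mc , FCond-suffix CU c k inP₂ f fc)
      where inP₂ : ∀ j → P₂ (pair (j + k))
            inP₂ j with split _ (inP (j + k))
            ... | inj₁ p₁ = ⊥-elim (no-P₁ (j , p₁))
            ... | inj₂ p₂ = p₂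

    -- The accessible y stays fixed while P₂ pairs extend the path from ν̄(tₖ) up to y;
    -- a P₁ pair gives a ⊏⁺ step below y, from which the descent restarts.
    mutual
      descend : ∀ {y} → Acc _⊏⁺_ y → ∀ k {Ξ} (ρ : Ren [] Ξ) → renP ρ (t̄ k) ⊏* y → ⊥
      descend y↓ k ρ r = P₁-recurs (suc k) λ (j , p₁) → reach-P₁ y↓ j k ρ r p₁

      reach-P₁ : ∀ {y} → Acc _⊏⁺_ y → ∀ j k {Ξ} (ρ : Ren [] Ξ) →
                 renP ρ (t̄ k) ⊏* y → P₁ (pair (j + suc k)) → ⊥
      reach-P₁ y↓ zero    k ρ r p₁ = descend-P₁ y↓ k ρ r p₁
      reach-P₁ y↓ (suc j) k ρ r p₁ with split _ (inP (suc k))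
      ... | inj₁ q₁ = descend-P₁ y↓ k ρ r q₁
      ... | inj₂ q₂ = reach-P₁ y↓ j (suc k) ρ (P₂-⊏* k ρ q₂ ◅◅ r)
                        (subst (λ n → P₁ (pair n)) (sym (+-suc j (suc k))) p₁)

      descend-P₁ : ∀ {y} → Acc _⊏⁺_ y → ∀ k {Ξ} (ρ : Ren [] Ξ) →
                   renP ρ (t̄ k) ⊏* y → P₁ (pair (suc k)) → ⊥
      descend-P₁ (acc y↓) k ρ r q₁ with P₁-⊏⁺ k ρ r q₁
      ... | _ , ρ' , lt = descend (y↓ lt) (suc k) ρ' ε

    t̄₀-terminating : Terminating R (proj₂ (t̄ 0))
    t̄₀-terminating = from-flag m atLeastMinimal (proj₂ (proj₂ wfM)) mc
      where
        from-flag : ∀ m' → AtLeastMinimal m' → FlagRulesWF m' → MCond CU m' c → Terminating R (proj₂ (t̄ 0))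
        from-flag minimal        _ _   (lift min)   = min 0 _ (ArgOf⇒▷ (Projects⇒ArgOf (t̄-Projects 0)))
        -- the computable instance is v = ν̄(p₀) with B = ∅; v is closed, so no binders are added
        from-flag (computable U) _ wfU (R⊆U , comp) =
          terminating-mono R⊆U (Comp⇒Terminating wfU (proj₁ (CU-isCU U)) _
            (comp 0 (λ _ → ⊥) (proj₂ (p̄ 0)) (sb-arg (Projects⇒ArgOf (proj⇒Projects _ (p̄-eq 0))) sb-refl)
                  (λ _ _ ()) (proj₂ (p̄ 0)) (λ ()) (λ ()) (ren-id (λ ()) _) (λ ())))

    contradiction : ⊥
    contradiction = descend (terminating⇒acc-⊏⁺ t̄₀-terminating) 0 (λ x → x)
                      (subst (λ u → ⌜ u ⌝ ⊏* ⌜ proj₂ (t̄ 0) ⌝) (sym (ren-id (λ _ → refl) _)) ε)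

  subterm-criterion : (CU : (Rule → Set) → BaseSet) → (∀ U → IsCU U (CU U)) →
                      (M N : DPProblem) → WFProblem M → ProcSubcrit M N →
                      (Finite CU N → Finite CU M) × (Infinite N → Infinite M)
  subterm-criterion CU CU-isCU ⟨ P , R , m , f ⟩ _ wfM (apply P₁ P₂ ν ap) = sound , complete
    where
      sound : Finite CU ⟨ P₂ , R , m , f ⟩ → Finite CU ⟨ P , R , m , f ⟩
      sound finN (c , mc , fc) = Soundness.contradiction CU CU-isCU ap wfM finN c mc fc

      complete : Infinite ⟨ P₂ , R , m , f ⟩ → Infinite ⟨ P , R , m , f ⟩
      complete (inj₁ nonterminating) = inj₁ nonterminating
      complete (inj₂ (c , cons)) = inj₂ (Chain-map (λ d p₂ → Applicable.unsplit ap d (inj₂ p₂)) c , cons)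
  subterm-criterion CU CU-isCU M .M wfM (other _) = (λ fin → fin) , (λ inf → inf)

theorem61 : (S : Signature) → let open Rewriting S in
    (CU : (Rule → Set) → BaseSet) → (∀ U → IsCU U (CU U)) →
    (M N : DPProblem) → WFProblem M → ProcSubcrit M N →
      (Finite CU N → Finite CU M) × (Infinite N → Infinite M)
theorem61 S = SubtermCriterion.subterm-criterion S
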